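{- Let $G$ be an equatorial graph with girth $g$ and equator $q$, let $k=\lceil g/2\rceil-1$, let $C=u_0,\dots,u_{q-1}$ be an isometric cycle of length $q$ in $G$, and let $L_i=\mathcal{D}_k(u_{i-k})\cap\mathcal{D}_k(u_{i+k})$ for $i\in\{0,\dots,q-1\}$ (indices mod $q$). If $D$ is any isometric cycle of length $q$ in $G$, then $|V(D)\cap L_i|=1$ for all $i\in\{0,\dots,q-1\}$.
   Context: For a vertex $u$, $\mathcal{D}_i(u)=\{v: d(u,v)\le i\}$. A cycle $C$ is isometric if $d_C(x,y)=d_G(x,y)$ for all $x,y\in V(C)$; the equator is the length of a longest isometric cycle. For $\delta\ge2$, $g\ge3$, $k=\lceil g/2\rceil-1$, the Moore bound is $M(\delta,g)=1+\sum_{i=0}^{k-1}\delta(\delta-1)^i$ for odd $g$ and $M(\delta,g)=2+\sum_{i=1}^{k}2(\delta-1)^i$ for even $g$. An equatorial graph is a finite graph with girth $g$, minimum degree $\delta$ and equator $q>6k+3$ whose order is exactly $\frac{q}{g}M(\delta,g)$. -}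

module Defs where

open import Data.Nat using (ℕ; zero; suc; _+_; _*_; _∸_; _^_; _≤_; _<_; _≡ᵇ_; _%_; _/_; ∣_-_∣; _⊓_)
open import Data.Nat.DivMod using (_mod_)
open import Data.Bool using (Bool; true; false; T; if_then_else_)
open import Data.Fin using (Fin; toℕ)
open import Data.List using (map)
open import Data.Nat.ListAction using (sum)
open import Data.List using () renaming (allFin to allFinL)
open import Data.Product using (Σ; ∃; _×_)
open import Relation.Binary.PropositionalEquality using (_≡_)
open import Function.Definitions using (Injective)

record Graph (n : ℕ) : Set where
  field
    adj    : Fin n → Fin n → Bool
    sym    : ∀ u v → adj u v ≡ adj v u
    irrefl : ∀ u → adj u u ≡ false

module _ {n : ℕ} (G : Graph n) where
  open Graph G

  Adj : Fin n → Fin n → Set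
  Adj u v = T (adj u v)

  data Walk : Fin n → Fin n → ℕ → Set where
    here : ∀ {u} → Walk u u 0
    step : ∀ {u w v m} → Adj u w → Walk w v m → Walk u v (suc m)

  Dist : Fin n → Fin n → ℕ → Set
  Dist u v m = Walk u v m × (∀ m' → Walk u v m' → m ≤ m')

  -- d(u,v) ≤ i, i.e. v ∈ 𝒟_i(u)
  InBall : ℕ → Fin n → Fin n → Set
  InBall i u v = Σ ℕ λ m → m ≤ i × Walk u v m

  degree : Fin n → ℕ
  degree u = sum (map (λ v → if adj u v then 1 else 0) (allFinL n))

  MinDegree : ℕ → Set
  MinDegree δ = (∀ u → δ ≤ degree u) × (∃ λ u → degree u ≡ δ)

shift : ∀ {m} → Fin m → ℕ → Fin m
shift {suc m} i s = (toℕ i + s) mod (suc m)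

cycDist : ∀ {m} → Fin m → Fin m → ℕ
cycDist {m} i j = ∣ toℕ i - toℕ j ∣ ⊓ (m ∸ ∣ toℕ i - toℕ j ∣)

module _ {n : ℕ} (G : Graph n) where

  IsCycle : (m : ℕ) → (Fin m → Fin n) → Set
  IsCycle m c = 3 ≤ m × Injective _≡_ _≡_ c × (∀ i → Adj G (c i) (c (shift i 1)))

  IsIsometricCycle : (m : ℕ) → (Fin m → Fin n) → Set
  IsIsometricCycle m c = IsCycle m c × (∀ i j → Dist G (c i) (c j) (cycDist i j))

  HasGirth : ℕ → Set
  HasGirth g = (Σ (Fin g → Fin n) λ c → IsCycle g c)
             × (∀ m (c : Fin m → Fin n) → IsCycle m c → g ≤ m)

  HasEquator : ℕ → Set
  HasEquator q = (Σ (Fin q → Fin n) λ c → IsIsometricCycle q c)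
               × (∀ m (c : Fin m → Fin n) → IsIsometricCycle m c → m ≤ q)

-- k = ⌈g/2⌉ - 1  ( = ⌊(g+1)/2⌋ - 1 )
kOf : ℕ → ℕ
kOf g = ((g + 1) / 2) ∸ 1

sumOdd : ℕ → ℕ → ℕ
sumOdd δ zero    = 0
sumOdd δ (suc k) = sumOdd δ k + δ * (δ ∸ 1) ^ k

sumEven : ℕ → ℕ → ℕ
sumEven δ zero    = 0
sumEven δ (suc k) = sumEven δ k + 2 * (δ ∸ 1) ^ (suc k)

moore : ℕ → ℕ → ℕ
moore δ g = if g % 2 ≡ᵇ 1 then 1 + sumOdd δ (kOf g) else 2 + sumEven δ (kOf g)

-- equatorial graph with girth g, minimum degree δ, equator q:
-- δ ≥ 2, g ≥ 3, q > 6k+3, and n = (q/g)·M(δ,g)  (stated as n·g = q·M(δ,g))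
Equatorial : ∀ {n} → Graph n → (g δ q : ℕ) → Set
Equatorial {n} G g δ q =
  2 ≤ δ × 3 ≤ g × HasGirth G g × MinDegree G δ × HasEquator G q
  × 6 * kOf g + 3 < q × n * g ≡ q * moore δ g

-- L_i = 𝒟_k(u_{i-k}) ∩ 𝒟_k(u_{i+k}) for the cycle u = c of length q
InL : ∀ {n} → Graph n → (k q : ℕ) → (Fin q → Fin n) → Fin q → Fin n → Set
InL G k q c i v = InBall G k (c (shift i (q ∸ k))) v × InBall G k (c (shift i k)) v

OnCycle : ∀ {n q} → (Fin q → Fin n) → Fin n → Set
OnCycle {q = q} d v = Σ (Fin q) λ j → d j ≡ v

{-# OPTIONS --safe #-}
module Submission where

-- Let k = ⌈g/2⌉ - 1. As the girth exceeds 2k, non-backtracking walks of length ≤ k from a vertex end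
-- at distinct vertices, so the radius-k ball around a vertex (g odd), or the union of the radius-k
-- balls around the two ends of an edge (g even), has at least M(δ, g) vertices.
-- Taking these sets at the q positions of C gives q·M(δ, g) = n·g incidences. Since C is isometric and
-- q > 6k + 3, the positions whose balls reach a given vertex v form an arc of at most 2k + 1 positions,
-- so v is counted at most g times; hence exactly g times, the arc is full, and v lies in L_s for its
-- midpoint s. This centre is unique and moves by at most one position along an edge. Sending each
-- position j of D to the centre of d_j thus gives a 1-Lipschitz self-map of the q-cycle keeping
-- antipodal positions at least 2 apart (they are far apart in D); such a map has to wind once around
-- the cycle, so it is onto, hence bijective.

open import Data.Nat using (ℕ; zero; suc; _+_; _*_; _∸_; _^_; _≤_; _<_; _<?_; _/_; _%_; _⊓_; ∣_-_∣; pred; z≤n; s≤s; s≤s⁻¹; z<s; >-nonZero)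
open import Data.Nat.Properties
open import Data.Nat.DivMod using (_mod_; m%n<n; [m+n]%n≡m%n; %-distribˡ-+; m%n%n≡m%n; m<n⇒m%n≡m; n%n≡0; m*n/n≡m; +-distrib-/; m*n%n≡0; [m+kn]%n≡m%n)
open import Data.Nat.Induction using (<-wellFounded)
open import Data.Nat.Tactic.RingSolver using (solve-∀)
import Data.Nat.ListAction as ListAction
open import Data.Bool using (Bool; true; false; T; _∨_; _∧_; not; if_then_else_)
open import Data.Bool.Properties using (T?; T-∧; T-∨)
open import Data.Fin using (Fin; zero; suc; toℕ; fromℕ<; punchOut)
open import Data.Fin.Properties using (any?; toℕ-injective; toℕ-fromℕ<; toℕ<n; punchOut-injective; injective⇒≤) renaming (_≟_ to _≟ᶠ_)
import Data.Fin.Properties as Fin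
open import Data.Fin.Permutation using (Permutation; permutation; _⟨$⟩ʳ_)
open import Data.List using (tabulate; map)
open import Data.Product using (Σ; ∃; _×_; _,_; proj₁; proj₂)
import Data.Product as Product
open import Data.Sum using (_⊎_; inj₁; inj₂; [_,_]′)
open import Data.Empty using (⊥; ⊥-elim)
open import Data.Unit using (tt)
open import Relation.Nullary using (yes; no; ¬_)
open import Relation.Nullary.Decidable using (_×-dec_; isYes; toWitness; fromWitness; toWitnessFalse; fromWitnessFalse)
open import Relation.Binary.PropositionalEquality
open import Relation.Binary.Definitions using (tri<; tri≈; tri>)
open import Induction.WellFounded using (Acc; acc)
open import Function using (_∘_; id; Equivalence)
open import Algebra.Properties.Semiring.Sum +-*-semiring
  using (sum; sum-syntax; ∑-comm; ∑-distrib-+; *-distribˡ-sum; *-distribʳ-sum; sum-cong-≗; sum-permute)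
open import Defs

∣m-n∣≤o⇒m≤n+o : ∀ {m n o} → ∣ m - n ∣ ≤ o → m ≤ n + o
∣m-n∣≤o⇒m≤n+o {m} {n} d≤o = ≤-trans (m≤n+∣m-n∣ m n) (+-monoʳ-≤ n d≤o)

∣m-n∣≤o⇒n≤m+o : ∀ {m n o} → ∣ m - n ∣ ≤ o → n ≤ m + o
∣m-n∣≤o⇒n≤m+o {m} {n} d≤o = ∣m-n∣≤o⇒m≤n+o {n} {m} (subst (_≤ _) (∣-∣-comm m n) d≤o)

bit : Bool → ℕ
bit b = if b then 1 else 0

bit≤1 : ∀ b → bit b ≤ 1
bit≤1 true  = ≤-refl
bit≤1 false = z≤n

anyᵇ : ∀ {N} → (Fin N → Bool) → Bool
anyᵇ {zero}  P = false
anyᵇ {suc N} P = P zero ∨ anyᵇ (P ∘ suc)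

anyᵇ-intro : ∀ {N} (P : Fin N → Bool) i → T (P i) → T (anyᵇ P)
anyᵇ-intro P zero    Pi with P zero
... | true = tt
anyᵇ-intro P (suc i) Pi with P zero
... | true  = tt
... | false = anyᵇ-intro (P ∘ suc) i Pi

anyᵇ-elim : ∀ {N} (P : Fin N → Bool) → T (anyᵇ P) → ∃ λ i → T (P i)
anyᵇ-elim {suc N} P any with P zero in eq
... | true  = zero , subst T (sym eq) tt
... | false with anyᵇ-elim (P ∘ suc) any
...   | i , Pi = suc i , Pi

count : ∀ {N} → (Fin N → Bool) → ℕ
count P = sum (bit ∘ P)

sum-mono-≤ : ∀ {N} {f g : Fin N → ℕ} → (∀ i → f i ≤ g i) → sum f ≤ sum g
sum-mono-≤ {zero}  f≤g = z≤n
sum-mono-≤ {suc N} f≤g = +-mono-≤ (f≤g zero) (sum-mono-≤ (f≤g ∘ suc))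

sum-const : ∀ N c → sum {N} (λ _ → c) ≡ N * c
sum-const zero    c = refl
sum-const (suc N) c = cong (c +_) (sum-const N c)

listSum-map-tabulate : ∀ {A : Set} {N} (f : A → ℕ) (g : Fin N → A) →
                       ListAction.sum (map f (tabulate g)) ≡ sum (f ∘ g)
listSum-map-tabulate {N = zero}  f g = refl
listSum-map-tabulate {N = suc N} f g = cong (f (g zero) +_) (listSum-map-tabulate f (g ∘ suc))

sum-≥-bound⇒term-≥ : ∀ {N} (f : Fin N → ℕ) c → (∀ i → f i ≤ c) → N * c ≤ sum f →
                      ∀ i → c ≤ f i
sum-≥-bound⇒term-≥ {suc N} f c f≤c N*c≤Σ zero =
  +-cancelʳ-≤ (N * c) c (f zero) (≤-trans N*c≤Σ (+-monoʳ-≤ (f zero) rest≤))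
  where
  rest≤ : sum (f ∘ suc) ≤ N * c
  rest≤ = ≤-trans (sum-mono-≤ (f≤c ∘ suc)) (≤-reflexive (sum-const N c))
sum-≥-bound⇒term-≥ {suc N} f c f≤c N*c≤Σ (suc i) =
  sum-≥-bound⇒term-≥ (f ∘ suc) c (f≤c ∘ suc)
    (+-cancelˡ-≤ c (N * c) _ (≤-trans N*c≤Σ (+-monoˡ-≤ _ (f≤c zero)))) i

count-mono : ∀ {N} {P R : Fin N → Bool} → (∀ i → T (P i) → T (R i)) → count P ≤ count R
count-mono {P = P} {R} P⇒R = sum-mono-≤ λ i → bit-mono (P i) (R i) (P⇒R i)
  where
  bit-mono : ∀ a b → (T a → T b) → bit a ≤ bit b
  bit-mono false _     _   = z≤n
  bit-mono true  true  _   = ≤-refl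
  bit-mono true  false a⇒b = ⊥-elim (a⇒b tt)

T⇒1≤bit : ∀ {b} → T b → 1 ≤ bit b
T⇒1≤bit {true} _ = ≤-refl

¬T⇒bit≤0 : ∀ {b} → ¬ T b → bit b ≤ 0
¬T⇒bit≤0 {false} _  = z≤n
¬T⇒bit≤0 {true}  ¬t = ⊥-elim (¬t tt)

count-≥-1 : ∀ {N} (P : Fin N → Bool) i → T (P i) → 1 ≤ count P
count-≥-1 P zero    P0 = ≤-trans (T⇒1≤bit P0) (m≤m+n _ _)
count-≥-1 P (suc i) Pi = ≤-trans (count-≥-1 (P ∘ suc) i Pi) (m≤n+m _ (bit (P zero)))

bit-∧ : ∀ a b → bit (a ∧ b) ≡ bit a * bit b
bit-∧ true  b = sym (+-identityʳ (bit b))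
bit-∧ false b = refl

count≡0 : ∀ {N} (P : Fin N → Bool) → (∀ i → ¬ T (P i)) → count P ≡ 0
count≡0 {zero}  P ¬P = refl
count≡0 {suc N} P ¬P with P zero | ¬P zero
... | false | _  = count≡0 (P ∘ suc) (¬P ∘ suc)
... | true  | ¬t = ⊥-elim (¬t tt)

count-≤-anyᵇ : ∀ {N} (P : Fin N → Bool) → (∀ i j → T (P i) → T (P j) → i ≡ j) →
               count P ≤ bit (anyᵇ P)
count-≤-anyᵇ {zero}  P unique = z≤n
count-≤-anyᵇ {suc N} P unique with P zero in eq
... | true  = ≤-reflexive (cong suc (count≡0 (P ∘ suc) λ i Pi →
                Fin.0≢1+n (unique zero (suc i) (subst T (sym eq) tt) Pi)))
... | false = count-≤-anyᵇ (P ∘ suc) λ i j Pi Pj → Fin.suc-injective (unique (suc i) (suc j) Pi Pj)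

count-≤-interval : ∀ {N} (P : Fin N → Bool) a m →
                   (∀ i → T (P i) → a ≤ toℕ i × toℕ i < a + m) → count P ≤ m
count-≤-interval {zero}  P a       m       inside = z≤n
count-≤-interval {suc N} P zero    zero    inside = ≤-reflexive (count≡0 P λ i Pi → n≮0 (proj₂ (inside i Pi)))
count-≤-interval {suc N} P zero    (suc m) inside =
  +-mono-≤ (bit≤1 (P zero)) (count-≤-interval (P ∘ suc) zero m λ i Pi → z≤n , s≤s⁻¹ (proj₂ (inside (suc i) Pi)))
count-≤-interval {suc N} P (suc a) m       inside =
  +-mono-≤ (¬T⇒bit≤0 (λ P0 → n≮0 (proj₁ (inside zero P0))))
           (count-≤-interval (P ∘ suc) a m λ i Pi → Product.map s≤s⁻¹ s≤s⁻¹ (inside (suc i) Pi))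

count-full⇒right-end : ∀ {N} (P : Fin N → Bool) a m →
                       (∀ i → T (P i) → a ≤ toℕ i × toℕ i < a + suc m) → suc m ≤ count P →
                       ∃ λ i → toℕ i ≡ a + m × T (P i)
count-full⇒right-end P a m inside full
  with any? (λ i → (toℕ i ≟ a + m) ×-dec T? (P i))
... | yes found = found
... | no  none  = ⊥-elim (<⇒≱ full (count-≤-interval P a m shorter))
  where
  shorter : ∀ i → T (P i) → a ≤ toℕ i × toℕ i < a + m
  shorter i Pi with inside i Pi
  ... | a≤i , i<a+1+m with m≤n⇒m<n∨m≡n (≤-pred (subst (toℕ i <_) (+-suc a m) i<a+1+m))
  ...   | inj₁ i<a+m = a≤i , i<a+m
  ...   | inj₂ i≡a+m = ⊥-elim (none (i , i≡a+m , Pi))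

least-true : ∀ {N} (P : Fin N → Bool) {j} → T (P j) →
             ∃ λ a → T (P a) × (∀ i → T (P i) → toℕ a ≤ toℕ i)
least-true P {zero} Pj = zero , Pj , λ _ _ → z≤n
least-true P {suc j} Pj with P zero in eq
... | true  = zero , subst T (sym eq) tt , λ _ _ → z≤n
... | false with least-true (P ∘ suc) Pj
...   | a , Pa , least = suc a , Pa , minimal
  where minimal : ∀ i → T (P i) → suc (toℕ a) ≤ toℕ i
        minimal zero    P0 = ⊥-elim (subst T eq P0)
        minimal (suc i) Pi = s≤s (least i Pi)

count-permute : ∀ {N} (P : Fin N → Bool) (π : Permutation N N) →
                count P ≡ count (λ i → P (π ⟨$⟩ʳ i))
count-permute P π = sum-permute (bit ∘ P) π

columns-full : ∀ {M N} (P : Fin M → Fin N → Bool) b c →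
               (∀ i → b ≤ count (P i)) → (∀ j → count (λ i → P i j) ≤ c) → N * c ≤ M * b →
               ∀ j → c ≤ count (λ i → P i j)
columns-full {M} {N} P b c rows columns N*c≤M*b =
  sum-≥-bound⇒term-≥ (λ j → count (λ i → P i j)) c columns (begin
    N * c                               ≤⟨ N*c≤M*b ⟩
    M * b                               ≡⟨ sum-const M b ⟨
    sum {M} (λ _ → b)                   ≤⟨ sum-mono-≤ rows ⟩
    sum (λ i → count (P i))             ≡⟨ ∑-comm (λ i j → bit (P i j)) ⟩
    sum (λ j → count (λ i → P i j))     ∎)
  where open ≤-Reasoning

injective⇒surjective : ∀ {N} (f : Fin N → Fin N) → (∀ {x y} → f x ≡ f y → x ≡ y) → ∀ i → ∃ λ j → f j ≡ i
injective⇒surjective {suc N} f injective i with any? (λ j → f j ≟ᶠ i)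
... | yes hit = hit
... | no miss = ⊥-elim (1+n≰n (injective⇒≤ {f = f′} injective′))
  where
  f′ : Fin (suc N) → Fin N
  f′ j = punchOut {i = i} {j = f j} (λ eq → miss (j , sym eq))
  injective′ : ∀ {x y} → f′ x ≡ f′ y → x ≡ y
  injective′ {x} {y} eq = injective (punchOut-injective (λ e → miss (x , sym e)) (λ e → miss (y , sym e)) eq)

surjective⇒injective : ∀ {N} (f : Fin N → Fin N) → (∀ i → ∃ λ j → f j ≡ i) → ∀ {x y} → f x ≡ f y → x ≡ y
surjective⇒injective {N} f surjective = injective
  where
  section : Fin N → Fin N
  section i = proj₁ (surjective i)
  inverse : ∀ i → f (section i) ≡ i
  inverse i = proj₂ (surjective i)
  section-injective : ∀ {i i′} → section i ≡ section i′ → i ≡ i′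
  section-injective {i} {i′} eq = trans (sym (inverse i)) (trans (cong f eq) (inverse i′))
  injective : ∀ {x y} → f x ≡ f y → x ≡ y
  injective {x} {y} fx≡fy with injective⇒surjective section section-injective x
                             | injective⇒surjective section section-injective y
  ... | a , refl | b , refl = cong section (trans (sym (inverse a)) (trans fx≡fy (inverse b)))

even-or-odd : ∀ m → ∃ λ h → m ≡ h + h ⊎ m ≡ suc (h + h)
even-or-odd zero = 0 , inj₁ refl
even-or-odd (suc m) with even-or-odd m
... | h , inj₁ m≡h+h   = h , inj₂ (cong suc m≡h+h)
... | h , inj₂ m≡1+h+h = suc h , inj₁ (cong suc (trans m≡1+h+h (sym (+-suc h h))))

-- 1 + (δ - 1) + … + (δ - 1)^t: the size of a depth-t branch of the δ-regular tree.
branchSize : ℕ → ℕ → ℕ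
branchSize δ zero    = 1
branchSize δ (suc t) = 1 + (δ ∸ 1) * branchSize δ t

branchSize-suc : ∀ δ t → branchSize δ (suc t) ≡ branchSize δ t + (δ ∸ 1) ^ suc t
branchSize-suc δ zero    = refl
branchSize-suc δ (suc t) = trans (cong (λ b → 1 + (δ ∸ 1) * b) (branchSize-suc δ t))
                                 (distrib (δ ∸ 1) (branchSize δ t) ((δ ∸ 1) ^ suc t))
  where distrib : ∀ d b p → 1 + d * (b + p) ≡ 1 + d * b + d * p
        distrib = solve-∀

sumOdd≡δ*branchSize : ∀ δ t → sumOdd δ (suc t) ≡ δ * branchSize δ t
sumOdd≡δ*branchSize δ zero    = refl
sumOdd≡δ*branchSize δ (suc t) = begin
  sumOdd δ (suc t) + δ * (δ ∸ 1) ^ suc t         ≡⟨ cong (_+ δ * (δ ∸ 1) ^ suc t) (sumOdd≡δ*branchSize δ t) ⟩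
  δ * branchSize δ t + δ * (δ ∸ 1) ^ suc t       ≡⟨ *-distribˡ-+ δ (branchSize δ t) _ ⟨
  δ * (branchSize δ t + (δ ∸ 1) ^ suc t)         ≡⟨ cong (δ *_) (branchSize-suc δ t) ⟨
  δ * branchSize δ (suc t)                       ∎
  where open ≡-Reasoning

2+sumEven≡2*branchSize : ∀ δ t → 2 + sumEven δ t ≡ 2 * branchSize δ t
2+sumEven≡2*branchSize δ zero    = refl
2+sumEven≡2*branchSize δ (suc t) = begin
  2 + (sumEven δ t + 2 * (δ ∸ 1) ^ suc t)        ≡⟨ +-assoc 2 (sumEven δ t) _ ⟨
  2 + sumEven δ t + 2 * (δ ∸ 1) ^ suc t          ≡⟨ cong (_+ 2 * (δ ∸ 1) ^ suc t) (2+sumEven≡2*branchSize δ t) ⟩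
  2 * branchSize δ t + 2 * (δ ∸ 1) ^ suc t       ≡⟨ *-distribˡ-+ 2 (branchSize δ t) _ ⟨
  2 * (branchSize δ t + (δ ∸ 1) ^ suc t)         ≡⟨ cong (2 *_) (branchSize-suc δ t) ⟨
  2 * branchSize δ (suc t)                       ∎
  where open ≡-Reasoning

kOf-odd : ∀ m → kOf (suc (m + m)) ≡ m
kOf-odd m = cong (_∸ 1) (trans (cong (_/ 2) (double m)) (m*n/n≡m (suc m) 2))
  where double : ∀ m → suc (m + m) + 1 ≡ suc m * 2
        double = solve-∀

kOf-even : ∀ m → kOf (suc (suc (m + m))) ≡ m
kOf-even m = cong (_∸ 1) (begin
  (suc (suc (m + m)) + 1) / 2       ≡⟨ cong (_/ 2) (double m) ⟩
  (1 + suc m * 2) / 2               ≡⟨ +-distrib-/ 1 (suc m * 2) (subst (λ r → 1 + r < 2) (sym (m*n%n≡0 (suc m) 2)) ≤-refl) ⟩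
  suc m * 2 / 2                     ≡⟨ m*n/n≡m (suc m) 2 ⟩
  suc m                             ∎)
  where open ≡-Reasoning
        double : ∀ m → suc (suc (m + m)) + 1 ≡ 1 + suc m * 2
        double = solve-∀

private
  odd%2 : ∀ m → suc (m + m) % 2 ≡ 1
  odd%2 m = trans (cong (_% 2) (double m)) ([m+kn]%n≡m%n 1 m 2)
    where double : ∀ m → suc (m + m) ≡ 1 + m * 2
          double = solve-∀

  even%2 : ∀ m → suc (suc (m + m)) % 2 ≡ 0
  even%2 m = trans (cong (_% 2) (double m)) (m*n%n≡0 (suc m) 2)
    where double : ∀ m → suc (suc (m + m)) ≡ suc m * 2
          double = solve-∀

moore-odd : ∀ δ m → moore δ (suc (m + m)) ≡ 1 + sumOdd δ (kOf (suc (m + m)))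
moore-odd δ m rewrite odd%2 m = refl

moore-even : ∀ δ m → moore δ (suc (suc (m + m))) ≡ 2 + sumEven δ (kOf (suc (suc (m + m))))
moore-even δ m rewrite even%2 m = refl

data GirthShape (δ g : ℕ) : Set where
  odd  : ∀ k′ → kOf g ≡ suc k′ → g ≡ suc (kOf g + kOf g) → moore δ g ≡ 1 + δ * branchSize δ k′ → GirthShape δ g
  even : g ≡ suc (suc (kOf g + kOf g)) → moore δ g ≡ 2 * branchSize δ (kOf g) → GirthShape δ g

girth-shape : ∀ δ g → 3 ≤ g → GirthShape δ g
girth-shape δ g 3≤g with even-or-odd g
... | zero , inj₁ refl = ⊥-elim (<⇒≱ 3≤g z≤n)
... | zero , inj₂ refl = ⊥-elim (<⇒≱ 3≤g (s≤s z≤n))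
... | suc m , inj₁ refl = even (subst (λ k → suc m + suc m ≡ suc (suc (k + k))) (sym k≡m) g≡) (begin
  moore δ (suc m + suc m)                    ≡⟨ cong (moore δ) g≡ ⟩
  moore δ (suc (suc (m + m)))                ≡⟨ moore-even δ m ⟩
  2 + sumEven δ (kOf (suc (suc (m + m))))    ≡⟨ cong (λ k → 2 + sumEven δ k) (kOf-even m) ⟩
  2 + sumEven δ m                            ≡⟨ 2+sumEven≡2*branchSize δ m ⟩
  2 * branchSize δ m                         ≡⟨ cong (λ k → 2 * branchSize δ k) k≡m ⟨
  2 * branchSize δ (kOf (suc m + suc m))     ∎)
  where
  open ≡-Reasoning
  g≡ : suc m + suc m ≡ suc (suc (m + m))
  g≡ = cong suc (+-suc m m)
  k≡m : kOf (suc m + suc m) ≡ m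
  k≡m = trans (cong kOf g≡) (kOf-even m)
... | suc k′ , inj₂ refl = odd k′ (kOf-odd (suc k′)) (cong (λ k → suc (k + k)) (sym (kOf-odd (suc k′)))) (begin
  moore δ (suc (suc k′ + suc k′))                   ≡⟨ moore-odd δ (suc k′) ⟩
  1 + sumOdd δ (kOf (suc (suc k′ + suc k′)))        ≡⟨ cong (λ k → 1 + sumOdd δ k) (kOf-odd (suc k′)) ⟩
  1 + sumOdd δ (suc k′)                             ≡⟨ cong (1 +_) (sumOdd≡δ*branchSize δ k′) ⟩
  1 + δ * branchSize δ k′                           ∎)
  where open ≡-Reasoning

module Cyclic (q' : ℕ) where

  Q : ℕ
  Q = suc q'

  pos : ℕ → Fin Q
  pos x = x mod Q

  toℕ-pos : ∀ x → toℕ (pos x) ≡ x % Q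
  toℕ-pos x = toℕ-fromℕ< (m%n<n x Q)

  pos-cong : ∀ x y → x % Q ≡ y % Q → pos x ≡ pos y
  pos-cong x y eq = toℕ-injective (trans (toℕ-pos x) (trans eq (sym (toℕ-pos y))))

  pos-toℕ : ∀ (i : Fin Q) → pos (toℕ i) ≡ i
  pos-toℕ i = toℕ-injective (trans (toℕ-pos (toℕ i)) (m<n⇒m%n≡m (toℕ<n i)))

  pos-+Q : ∀ x → pos (x + Q) ≡ pos x
  pos-+Q x = pos-cong (x + Q) x ([m+n]%n≡m%n x Q)

  pos-%ˡ : ∀ x y → pos (x % Q + y) ≡ pos (x + y)
  pos-%ˡ x y = pos-cong (x % Q + y) (x + y) (begin
    (x % Q + y) % Q          ≡⟨ %-distribˡ-+ (x % Q) y Q ⟩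
    (x % Q % Q + y % Q) % Q  ≡⟨ cong (λ z → (z + y % Q) % Q) (m%n%n≡m%n x Q) ⟩
    (x % Q + y % Q) % Q      ≡⟨ %-distribˡ-+ x y Q ⟨
    (x + y) % Q              ∎)
    where open ≡-Reasoning

  shift-pos : ∀ x s → shift (pos x) s ≡ pos (x + s)
  shift-pos x s = trans (cong (λ z → pos (z + s)) (toℕ-pos x)) (pos-%ˡ x s)

  shift-shift : ∀ (i : Fin Q) s t → shift (shift i s) t ≡ shift i (s + t)
  shift-shift i s t = trans (shift-pos (toℕ i + s) t) (cong pos (+-assoc (toℕ i) s t))

  shift-comm : ∀ (i : Fin Q) s t → shift (shift i s) t ≡ shift (shift i t) s
  shift-comm i s t = trans (shift-shift i s t) (trans (cong (shift i) (+-comm s t)) (sym (shift-shift i t s)))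

  shift-suc : ∀ (i : Fin Q) s → shift (shift i s) 1 ≡ shift i (suc s)
  shift-suc i s = trans (shift-shift i s 1) (cong (shift i) (+-comm s 1))

  shift-zero : ∀ (i : Fin Q) → shift i 0 ≡ i
  shift-zero i = trans (cong pos (+-identityʳ (toℕ i))) (pos-toℕ i)

  shift-Q : ∀ (i : Fin Q) → shift i Q ≡ i
  shift-Q i = trans (pos-+Q (toℕ i)) (pos-toℕ i)

  shift-inverseˡ : ∀ (i : Fin Q) {t} → t ≤ Q → shift (shift i (Q ∸ t)) t ≡ i
  shift-inverseˡ i {t} t≤Q = trans (shift-shift i (Q ∸ t) t) (trans (cong (shift i) (m∸n+n≡m t≤Q)) (shift-Q i))

  shift-inverseʳ : ∀ (i : Fin Q) {t} → t ≤ Q → shift (shift i t) (Q ∸ t) ≡ i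
  shift-inverseʳ i {t} t≤Q = trans (shift-comm i t (Q ∸ t)) (shift-inverseˡ i t≤Q)

  shift-toℕ : ∀ (i j : Fin Q) t → shift i (toℕ (shift j t)) ≡ shift j (toℕ i + t)
  shift-toℕ i j t = begin
    pos (toℕ i + toℕ (shift j t))   ≡⟨ cong (λ z → pos (toℕ i + z)) (toℕ-pos (toℕ j + t)) ⟩
    pos (toℕ i + (toℕ j + t) % Q)   ≡⟨ cong pos (+-comm (toℕ i) _) ⟩
    pos ((toℕ j + t) % Q + toℕ i)   ≡⟨ pos-%ˡ (toℕ j + t) (toℕ i) ⟩
    pos (toℕ j + t + toℕ i)         ≡⟨ cong pos (+-assoc (toℕ j) t (toℕ i)) ⟩
    pos (toℕ j + (t + toℕ i))       ≡⟨ cong (λ z → pos (toℕ j + z)) (+-comm t (toℕ i)) ⟩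
    pos (toℕ j + (toℕ i + t))       ∎
    where open ≡-Reasoning

  toℕ-shift : ∀ (i : Fin Q) t → toℕ i + t < Q → toℕ (shift i t) ≡ toℕ i + t
  toℕ-shift i t lt = trans (toℕ-pos (toℕ i + t)) (m<n⇒m%n≡m lt)

  shift-injective : ∀ {i j : Fin Q} t → t ≤ Q → shift i t ≡ shift j t → i ≡ j
  shift-injective {i} {j} t t≤Q eq =
    trans (sym (shift-inverseʳ i t≤Q)) (trans (cong (λ z → shift z (Q ∸ t)) eq) (shift-inverseʳ j t≤Q))

  rotation : Fin Q → Permutation Q Q
  rotation b = permutation (λ i → shift i (toℕ b)) (λ i → shift i (Q ∸ toℕ b))
                           (λ i → shift-inverseˡ i b≤Q) (λ i → shift-inverseʳ i b≤Q)
    where b≤Q = <⇒≤ (toℕ<n b)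

  shift-one : ∀ (i : Fin Q) → (toℕ i ≡ q' × toℕ (shift i 1) ≡ 0) ⊎ (toℕ i < q' × toℕ (shift i 1) ≡ suc (toℕ i))
  shift-one i with m≤n⇒m<n∨m≡n (≤-pred (toℕ<n i))
  ... | inj₁ i<q' = inj₂ (i<q' , trans (toℕ-shift i 1 (s≤s (subst (_≤ q') (+-comm 1 (toℕ i)) i<q'))) (+-comm (toℕ i) 1))
  ... | inj₂ i≡q' = inj₁ (i≡q' , trans (toℕ-pos (toℕ i + 1))
                                        (trans (cong (_% Q) (trans (+-comm (toℕ i) 1) (cong suc i≡q'))) (n%n≡0 Q)))

  -- cycDist i j unfolds to ∥ ∣ toℕ i - toℕ j ∣ ∥.
  ∥_∥ : ℕ → ℕ
  ∥ d ∥ = d ⊓ (Q ∸ d)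

  ∥Q∸d∥≡∥d∥ : ∀ {d} → d ≤ Q → ∥ Q ∸ d ∥ ≡ ∥ d ∥
  ∥Q∸d∥≡∥d∥ {d} d≤Q = trans (cong ((Q ∸ d) ⊓_) (m∸[m∸n]≡n d≤Q)) (⊓-comm (Q ∸ d) d)

  ∥d∥≤m⇒ : ∀ {d m} → ∥ d ∥ ≤ m → d ≤ m ⊎ Q ≤ d + m
  ∥d∥≤m⇒ {d} {m} le with ⊓-sel d (Q ∸ d)
  ... | inj₁ eq = inj₁ (subst (_≤ m) eq le)
  ... | inj₂ eq = inj₂ (≤-trans (m≤n+m∸n Q d) (+-monoʳ-≤ d (subst (_≤ m) eq le)))

  ∣toℕ-toℕ∣<Q : ∀ (i j : Fin Q) → ∣ toℕ i - toℕ j ∣ < Q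
  ∣toℕ-toℕ∣<Q i j = ≤-<-trans (∣m-n∣≤m⊔n (toℕ i) (toℕ j)) (⊔-lub (toℕ<n i) (toℕ<n j))

  cycDist-sym : ∀ (i j : Fin Q) → cycDist i j ≡ cycDist j i
  cycDist-sym i j = cong ∥_∥ (∣-∣-comm (toℕ i) (toℕ j))

  cycDist≤0⇒≡ : ∀ {i j : Fin Q} → cycDist i j ≤ 0 → i ≡ j
  cycDist≤0⇒≡ {i} {j} le with ∥d∥≤m⇒ le
  ... | inj₁ d≤0 = toℕ-injective (∣m-n∣≡0⇒m≡n (n≤0⇒n≡0 d≤0))
  ... | inj₂ Q≤d = ⊥-elim (<⇒≱ (∣toℕ-toℕ∣<Q i j) (subst (Q ≤_) (+-identityʳ _) Q≤d))

  cycDist-shift-one : ∀ (i j : Fin Q) → cycDist (shift i 1) (shift j 1) ≡ cycDist i j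
  cycDist-shift-one i j with shift-one i | shift-one j
  ... | inj₂ (_ , si) | inj₂ (_ , sj) rewrite si | sj = refl
  ... | inj₁ (i≡q' , si) | inj₁ (j≡q' , sj) rewrite si | sj | i≡q' | j≡q' | ∣n-n∣≡0 q' = refl
  ... | inj₁ (i≡q' , si) | inj₂ (j<q' , sj) rewrite si | sj | i≡q' =
    trans (sym (∥Q∸d∥≡∥d∥ (s≤s (<⇒≤ j<q')))) (cong ∥_∥ (sym (m≤n⇒∣n-m∣≡n∸m (<⇒≤ j<q'))))
  ... | inj₂ (i<q' , si) | inj₁ (j≡q' , sj) rewrite si | sj | j≡q' =
    trans (sym (∥Q∸d∥≡∥d∥ (s≤s (<⇒≤ i<q')))) (cong ∥_∥ (sym (m≤n⇒∣m-n∣≡n∸m (<⇒≤ i<q'))))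

  cycDist-shift : ∀ (i j : Fin Q) s → cycDist (shift i s) (shift j s) ≡ cycDist i j
  cycDist-shift i j zero = cong₂ cycDist (shift-zero i) (shift-zero j)
  cycDist-shift i j (suc s) = begin
    cycDist (shift i (suc s)) (shift j (suc s))              ≡⟨ cong₂ cycDist (shift-suc i s) (shift-suc j s) ⟨
    cycDist (shift (shift i s) 1) (shift (shift j s) 1)      ≡⟨ cycDist-shift-one (shift i s) (shift j s) ⟩
    cycDist (shift i s) (shift j s)                          ≡⟨ cycDist-shift i j s ⟩
    cycDist i j                                              ∎
    where open ≡-Reasoning

  cycDist-shiftʳ : ∀ (i : Fin Q) r → r < Q → cycDist i (shift i r) ≡ ∥ r ∥
  cycDist-shiftʳ i r r<Q = begin
    cycDist i (shift i r)                                          ≡⟨ cong₂ cycDist (pos-toℕ i) moved ⟨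
    cycDist (shift zero (toℕ i)) (shift (fromℕ< r<Q) (toℕ i))     ≡⟨ cycDist-shift zero (fromℕ< r<Q) (toℕ i) ⟩
    cycDist zero (fromℕ< r<Q)                                     ≡⟨ cong ∥_∥ (toℕ-fromℕ< r<Q) ⟩
    ∥ r ∥                                                         ∎
    where
    open ≡-Reasoning
    moved : shift (fromℕ< r<Q) (toℕ i) ≡ shift i r
    moved = trans (cong (λ z → pos (z + toℕ i)) (toℕ-fromℕ< r<Q)) (cong pos (+-comm r (toℕ i)))

  private
    witness-≤ : ∀ (i j : Fin Q) → toℕ i ≤ toℕ j → j ≡ shift i (cycDist i j) ⊎ i ≡ shift j (cycDist i j)
    witness-≤ i j i≤j with m≤n⇒∃[o]m+o≡n i≤j
    ... | d , x+d≡y = case (⊓-sel ∣ toℕ i - toℕ j ∣ (Q ∸ ∣ toℕ i - toℕ j ∣))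
      where
      open ≡-Reasoning
      ∣x-y∣≡d : ∣ toℕ i - toℕ j ∣ ≡ d
      ∣x-y∣≡d = trans (m≤n⇒∣m-n∣≡n∸m i≤j) (trans (cong (_∸ toℕ i) (sym x+d≡y)) (m+n∸m≡n (toℕ i) d))
      d≤Q : d ≤ Q
      d≤Q = ≤-trans (m≤n+m d (toℕ i)) (≤-trans (≤-reflexive x+d≡y) (<⇒≤ (toℕ<n j)))
      case : cycDist i j ≡ ∣ toℕ i - toℕ j ∣ ⊎ cycDist i j ≡ Q ∸ ∣ toℕ i - toℕ j ∣ →
             j ≡ shift i (cycDist i j) ⊎ i ≡ shift j (cycDist i j)
      case (inj₁ eq) = inj₁ (begin
        j                          ≡⟨ pos-toℕ j ⟨
        pos (toℕ j)                ≡⟨ cong pos x+d≡y ⟨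
        pos (toℕ i + d)            ≡⟨ cong (λ z → pos (toℕ i + z)) (trans eq ∣x-y∣≡d) ⟨
        shift i (cycDist i j)      ∎)
      case (inj₂ eq) = inj₂ (begin
        i                            ≡⟨ shift-Q i ⟨
        pos (toℕ i + Q)              ≡⟨ cong (λ z → pos (toℕ i + z)) (m+[n∸m]≡n d≤Q) ⟨
        pos (toℕ i + (d + (Q ∸ d)))  ≡⟨ cong pos (+-assoc (toℕ i) d (Q ∸ d)) ⟨
        pos (toℕ i + d + (Q ∸ d))    ≡⟨ cong (λ z → pos (z + (Q ∸ d))) x+d≡y ⟩
        pos (toℕ j + (Q ∸ d))        ≡⟨ cong (λ z → pos (toℕ j + (Q ∸ z))) ∣x-y∣≡d ⟨
        pos (toℕ j + (Q ∸ ∣ toℕ i - toℕ j ∣))  ≡⟨ cong (λ z → pos (toℕ j + z)) eq ⟨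
        shift j (cycDist i j)        ∎)

  cycDist-witness : ∀ (i j : Fin Q) → j ≡ shift i (cycDist i j) ⊎ i ≡ shift j (cycDist i j)
  cycDist-witness i j with ≤-total (toℕ i) (toℕ j)
  ... | inj₁ i≤j = witness-≤ i j i≤j
  ... | inj₂ j≤i with witness-≤ j i j≤i
  ...   | inj₁ eq = inj₂ (trans eq (cong (shift j) (cycDist-sym j i)))
  ...   | inj₂ eq = inj₁ (trans eq (cong (shift i) (cycDist-sym j i)))

  cycDist≤⇒ : ∀ {i j : Fin Q} {m} → cycDist i j ≤ m → ∣ toℕ i - toℕ j ∣ ≤ m ⊎ Q ≤ ∣ toℕ i - toℕ j ∣ + m
  cycDist≤⇒ le = ∥d∥≤m⇒ le

module Arc (q' K : ℕ) (room : 3 * K + 3 ≤ suc q') where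

  open Cyclic q'

  Clustered : (Fin Q → Bool) → Set
  Clustered P = ∀ i j → T (P i) → T (P j) → cycDist i j ≤ K

  thicken : (Fin Q → Bool) → Fin Q → Bool
  thicken P i = P i ∨ P (shift i 1)

  HasArc : (Fin Q → Bool) → Set
  HasArc P = ∃ λ a → T (P a) × T (P (shift a K))

  private
    K+K+3≤Q : suc (suc (suc (K + K))) ≤ Q
    K+K+3≤Q = ≤-trans (m≤m+n _ K) (≤-trans (≤-reflexive (eq K)) room)
      where eq : ∀ K → suc (suc (suc (K + K))) + K ≡ 3 * K + 3
            eq = solve-∀

    3K<Q : K + K + K < Q
    3K<Q = ≤-trans (m≤m+n _ 2) (≤-trans (≤-reflexive (eq K)) room)
      where eq : ∀ K → suc (K + K + K) + 2 ≡ 3 * K + 3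
            eq = solve-∀

    1+K<Q : suc K < Q
    1+K<Q = ≤-trans (s≤s (s≤s (m≤m+n K K))) (≤-trans (n≤1+n _) K+K+3≤Q)

    ∣x-1+K∣+K<Q : ∀ x → x < Q → ∣ x - suc K ∣ + K < Q
    ∣x-1+K∣+K<Q x x<Q with ≤-total x (suc K)
    ... | inj₁ x≤1+K = ≤-<-trans (+-monoˡ-≤ K (≤-trans (∣m-n∣≤m⊔n x (suc K)) (≤-reflexive (m≤n⇒m⊔n≡n x≤1+K))))
                                 (≤-trans (n≤1+n _) K+K+3≤Q)
    ... | inj₂ 1+K≤x = begin-strict
      ∣ x - suc K ∣ + K    ≡⟨ cong (_+ K) (m≤n⇒∣n-m∣≡n∸m 1+K≤x) ⟩
      x ∸ suc K + K        <⟨ +-monoʳ-< (x ∸ suc K) (n<1+n K) ⟩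
      x ∸ suc K + suc K    ≡⟨ m∸n+n≡m 1+K≤x ⟩
      x                    <⟨ x<Q ⟩
      Q                    ∎
      where open ≤-Reasoning

  -- Read from origin, P lies in [toℕ left, toℕ left + K]; the bounds on left keep this window
  -- and the position before it clear of the wrap-around from Q - 1 to 0.
  record Window (P : Fin Q → Bool) : Set where
    field
      origin  : Fin Q
      left    : Fin Q
      at-left : T (P (shift left (toℕ origin)))
      1≤left  : 1 ≤ toℕ left
      left≤   : toℕ left ≤ suc K
      inside  : ∀ i → T (P (shift i (toℕ origin))) → toℕ left ≤ toℕ i × toℕ i ≤ toℕ left + K

    P′ : Fin Q → Bool
    P′ i = P (shift i (toℕ origin))

    count-P′ : count P ≡ count P′
    count-P′ = count-permute P (rotation origin)

    right-end : ∀ j → toℕ j ≡ toℕ left + K → T (P′ j) → HasArc P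
    right-end j j≡left+K P′j = shift left (toℕ origin) , at-left , subst (T ∘ P) moved P′j
      where
      left+K<Q : toℕ left + K < Q
      left+K<Q = ≤-trans (s≤s (+-monoˡ-≤ K left≤)) (≤-trans (n≤1+n _) K+K+3≤Q)
      moved : shift j (toℕ origin) ≡ shift (shift left (toℕ origin)) K
      moved = trans (cong (λ z → shift z (toℕ origin))
                      (toℕ-injective (trans j≡left+K (sym (toℕ-shift left K left+K<Q)))))
                    (shift-comm left K (toℕ origin))

    inside-next : ∀ i → T (P′ (shift i 1)) → toℕ left ≤ suc (toℕ i) × suc (toℕ i) ≤ toℕ left + K
    inside-next i P′i+1 with shift-one i | inside (shift i 1) P′i+1
    ... | inj₁ (_ , i+1≡0) | left≤i+1 , _ = ⊥-elim (<⇒≱ 1≤left (subst (toℕ left ≤_) i+1≡0 left≤i+1))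
    ... | inj₂ (_ , i+1≡) | bounds = subst (λ z → toℕ left ≤ z × z ≤ toℕ left + K) i+1≡ bounds

    inside′ : ∀ i → T (P′ i) → toℕ left ≤ toℕ i × toℕ i < toℕ left + suc K
    inside′ i P′i = proj₁ (inside i P′i) , subst (toℕ i <_) (sym (+-suc _ K)) (s≤s (proj₂ (inside i P′i)))

    count-≤ : count P ≤ suc K
    count-≤ = subst (_≤ suc K) (sym count-P′) (count-≤-interval P′ (toℕ left) (suc K) inside′)

    count-full : suc K ≤ count P → HasArc P
    count-full K+1≤ =
      let j , j≡ , P′j = count-full⇒right-end P′ (toℕ left) K inside′ (subst (suc K ≤_) count-P′ K+1≤)
      in right-end j j≡ P′j

    R′ : Fin Q → Bool
    R′ i = thicken P (shift i (toℕ origin))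

    count-R′ : count (thicken P) ≡ count R′
    count-R′ = count-permute (thicken P) (rotation origin)

    before : ℕ
    before = pred (toℕ left)

    1+before≡left : suc before ≡ toℕ left
    1+before≡left = suc-pred (toℕ left) ⦃ >-nonZero 1≤left ⦄

    R′-split : ∀ i → T (R′ i) → T (P′ i) ⊎ T (P′ (shift i 1))
    R′-split i R′i with Equivalence.to T-∨ R′i
    ... | inj₁ P′i = inj₁ P′i
    ... | inj₂ P′i+1 = inj₂ (subst (T ∘ P) (shift-comm i (toℕ origin) 1) P′i+1)

    before+1+K≡ : before + suc K ≡ toℕ left + K
    before+1+K≡ = trans (+-suc before K) (cong (_+ K) 1+before≡left)

    before+2+K≡ : before + suc (suc K) ≡ suc (toℕ left + K)
    before+2+K≡ = trans (+-suc before (suc K)) (cong suc before+1+K≡)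

    thick-inside : ∀ i → T (R′ i) → before ≤ toℕ i × toℕ i < before + suc (suc K)
    thick-inside i R′i with R′-split i R′i
    ... | inj₁ P′i = let left≤i , i≤left+K = inside i P′i in
      ≤-trans (n≤1+n before) (subst (_≤ toℕ i) (sym 1+before≡left) left≤i) ,
      subst (toℕ i <_) (sym before+2+K≡) (s≤s i≤left+K)
    ... | inj₂ P′i+1 = let left≤1+i , 1+i≤left+K = inside-next i P′i+1 in
      s≤s⁻¹ (subst (_≤ suc (toℕ i)) (sym 1+before≡left) left≤1+i) ,
      subst (toℕ i <_) (sym before+2+K≡) (≤-trans 1+i≤left+K (n≤1+n _))

    thick-right-end : ∀ j → toℕ j ≡ before + suc K → T (R′ j) → HasArc P
    thick-right-end j j≡ R′j with R′-split j R′j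
    ... | inj₁ P′j = right-end j (trans j≡ before+1+K≡) P′j
    ... | inj₂ P′j+1 =
      ⊥-elim (1+n≰n (subst (λ z → suc z ≤ toℕ left + K) (trans j≡ before+1+K≡) (proj₂ (inside-next j P′j+1))))

    thick-count-≤ : count (thicken P) ≤ suc (suc K)
    thick-count-≤ = subst (_≤ suc (suc K)) (sym count-R′) (count-≤-interval R′ before (suc (suc K)) thick-inside)

    thick-count-full : suc (suc K) ≤ count (thicken P) → HasArc P
    thick-count-full K+2≤ =
      let j , j≡ , R′j = count-full⇒right-end R′ before (suc K) thick-inside (subst (suc (suc K) ≤_) count-R′ K+2≤)
      in thick-right-end j j≡ R′j

  window : ∀ {P} → Clustered P → ∀ s → T (P s) → Window P
  -- Rotating s to position K + 1 puts P inside [1, 2K + 1]; left is its least point there.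
  window {P} clustered s Ps = record
    { origin = o ; left = a ; at-left = Pa ; 1≤left = proj₁ (near-centre a Pa)
    ; left≤ = subst (toℕ a ≤_) (toℕ-fromℕ< 1+K<Q) (minimal centre Pcentre)
    ; inside = inside }
    where
    o = shift s (Q ∸ suc K)
    b = toℕ o
    centre = fromℕ< 1+K<Q
    P′ : Fin Q → Bool
    P′ i = P (shift i b)
    centre↦s : shift centre b ≡ s
    centre↦s = begin
      shift centre b                      ≡⟨ shift-toℕ centre s (Q ∸ suc K) ⟩
      shift s (toℕ centre + (Q ∸ suc K))  ≡⟨ cong (λ z → shift s (z + (Q ∸ suc K))) (toℕ-fromℕ< 1+K<Q) ⟩
      shift s (suc K + (Q ∸ suc K))       ≡⟨ cong (shift s) (m+[n∸m]≡n (<⇒≤ 1+K<Q)) ⟩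
      shift s Q                           ≡⟨ shift-Q s ⟩
      s                                   ∎
      where open ≡-Reasoning
    Pcentre : T (P′ centre)
    Pcentre = subst (T ∘ P) (sym centre↦s) Ps
    close : ∀ i j → T (P′ i) → T (P′ j) → cycDist i j ≤ K
    close i j Pi Pj = subst (_≤ K) (cycDist-shift i j b) (clustered (shift i b) (shift j b) Pi Pj)
    near-centre : ∀ i → T (P′ i) → 1 ≤ toℕ i × toℕ i ≤ suc (K + K)
    near-centre i Pi = bounds (subst (λ c → ∣ toℕ i - c ∣ ≤ K ⊎ Q ≤ ∣ toℕ i - c ∣ + K) (toℕ-fromℕ< 1+K<Q)
                                     (cycDist≤⇒ {i} {centre} (close i centre Pi Pcentre)))
      where
      bounds : ∣ toℕ i - suc K ∣ ≤ K ⊎ Q ≤ ∣ toℕ i - suc K ∣ + K → 1 ≤ toℕ i × toℕ i ≤ suc (K + K)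
      bounds (inj₁ d≤K)   = +-cancelʳ-≤ K 1 (toℕ i) (∣m-n∣≤o⇒n≤m+o {toℕ i} d≤K) , ∣m-n∣≤o⇒m≤n+o {toℕ i} d≤K
      bounds (inj₂ Q≤d+K) = ⊥-elim (<⇒≱ (∣x-1+K∣+K<Q (toℕ i) (toℕ<n i)) Q≤d+K)
    least : ∃ λ a → T (P′ a) × (∀ i → T (P′ i) → toℕ a ≤ toℕ i)
    least = least-true P′ {centre} Pcentre
    a : Fin Q
    a = proj₁ least
    Pa : T (P′ a)
    Pa = proj₁ (proj₂ least)
    minimal : ∀ i → T (P′ i) → toℕ a ≤ toℕ i
    minimal = proj₂ (proj₂ least)
    inside : ∀ i → T (P′ i) → toℕ a ≤ toℕ i × toℕ i ≤ toℕ a + K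
    inside i Pi = minimal i Pi , right (cycDist≤⇒ {a} {i} (close a i Pa Pi))
      where
      right : ∣ toℕ a - toℕ i ∣ ≤ K ⊎ Q ≤ ∣ toℕ a - toℕ i ∣ + K → toℕ i ≤ toℕ a + K
      right (inj₁ d≤K)   = ∣m-n∣≤o⇒n≤m+o {toℕ a} {toℕ i} d≤K
      right (inj₂ Q≤d+K) = ⊥-elim (<⇒≱ 3K<Q (≤-trans Q≤d+K (+-monoˡ-≤ K d≤2K)))
        where
        d≤2K : ∣ toℕ a - toℕ i ∣ ≤ K + K
        d≤2K = begin
          ∣ toℕ a - toℕ i ∣        ≡⟨ m≤n⇒∣m-n∣≡n∸m (minimal i Pi) ⟩
          toℕ i ∸ toℕ a            ≤⟨ ∸-mono (proj₂ (near-centre i Pi)) (proj₁ (near-centre a Pa)) ⟩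
          suc (K + K) ∸ 1          ∎
          where open ≤-Reasoning

  clustered-count : ∀ {P} → Clustered P → count P ≤ suc K × (suc K ≤ count P → HasArc P)
  clustered-count {P} clustered with any? (λ i → T? (P i))
  ... | no none = subst (_≤ suc K) (sym empty) z≤n ,
                  λ full → ⊥-elim (<⇒≱ (s≤s z≤n) (subst (suc K ≤_) empty full))
    where empty = count≡0 P (λ i Pi → none (i , Pi))
  ... | yes (s , Ps) = count-≤ , count-full
    where open Window (window clustered s Ps)

  clustered-thick-count : ∀ {P} → Clustered P →
                          count (thicken P) ≤ suc (suc K) × (suc (suc K) ≤ count (thicken P) → HasArc P)
  clustered-thick-count {P} clustered with any? (λ i → T? (P i))
  ... | no none = subst (_≤ suc (suc K)) (sym empty) z≤n ,
                  λ full → ⊥-elim (<⇒≱ (s≤s z≤n) (subst (suc (suc K) ≤_) empty full))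
    where empty = count≡0 (thicken P) λ i Ri →
                    [ (λ Pi → none (i , Pi)) , (λ Pi+1 → none (shift i 1 , Pi+1)) ]′ (Equivalence.to T-∨ Ri)
  ... | yes (s , Ps) = thick-count-≤ , thick-count-full
    where open Window (window clustered s Ps)

module Winding (q' h : ℕ) (halves : suc q' ≡ h + h ⊎ suc q' ≡ suc (h + h)) where

  open Cyclic q'

  h+h≤Q : h + h ≤ Q
  h+h≤Q = [ (λ Q≡h+h → ≤-reflexive (sym Q≡h+h)) , (λ Q≡1+h+h → subst (h + h ≤_) (sym Q≡1+h+h) (n≤1+n _)) ]′ halves

  Q≤1+h+h : Q ≤ suc (h + h)
  Q≤1+h+h = [ (λ Q≡h+h → subst (_≤ suc (h + h)) (sym Q≡h+h) (n≤1+n _)) , ≤-reflexive ]′ halves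

  h<Q : h < Q
  h<Q = below h halves
    where
    below : ∀ h′ → Q ≡ h′ + h′ ⊎ Q ≡ suc (h′ + h′) → h′ < Q
    below zero     (inj₁ ())
    below (suc h′) (inj₁ Q≡h+h)   = subst (suc h′ <_) (sym Q≡h+h) (m<m+n (suc h′) z<s)
    below h′       (inj₂ Q≡1+h+h) = subst (h′ <_) (sym Q≡1+h+h) (s≤s (m≤m+n h′ h′))

  1-Lipschitz : (Fin Q → Fin Q) → Set
  1-Lipschitz σ = ∀ j → cycDist (σ j) (σ (shift j 1)) ≤ 1

  SeparatesAntipodes : (Fin Q → Fin Q) → Set
  SeparatesAntipodes σ = ∀ j → 2 ≤ cycDist (σ j) (σ (shift j h))

  -- A map avoiding the last point can be read as a map into the path 0, …, q' - 1,
  -- where the gap between σ j and σ (j + h) can never change sign, yet it must after going once round.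
  module AvoidingLast (σ : Fin Q → Fin Q) (lipschitz : 1-Lipschitz σ) (separates : SeparatesAntipodes σ)
                      (avoids : ∀ j → toℕ (σ j) ≢ q') where
    p : Fin Q → ℕ
    p j = toℕ (σ j)

    p<q' : ∀ j → p j < q'
    p<q' j = ≤∧≢⇒< (≤-pred (toℕ<n (σ j))) (avoids j)

    moves : ∀ j → p (shift j 1) ≤ suc (p j) × p j ≤ suc (p (shift j 1))
    moves j with cycDist≤⇒ {σ j} {σ (shift j 1)} (lipschitz j)
    ... | inj₁ d≤1 = subst (p (shift j 1) ≤_) (+-comm (p j) 1) (∣m-n∣≤o⇒n≤m+o {p j} d≤1) ,
                     subst (p j ≤_) (+-comm (p (shift j 1)) 1) (∣m-n∣≤o⇒m≤n+o {p j} d≤1)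
    ... | inj₂ Q≤d+1 = ⊥-elim (<⇒≱ (s≤s (≤-<-trans (∣m-n∣≤m⊔n (p j) _) (⊔-lub (p<q' j) (p<q' (shift j 1)))))
                                    (subst (Q ≤_) (+-comm _ 1) Q≤d+1))

    Up Down : Fin Q → Set
    Up   j = suc (suc (p j)) ≤ p (shift j h)
    Down j = suc (suc (p (shift j h))) ≤ p j

    up-or-down : ∀ j → Up j ⊎ Down j
    up-or-down j with ≤-total (p j) (p (shift j h))
    ... | inj₁ below = inj₁ (begin
      2 + p j                          ≡⟨ +-comm 2 (p j) ⟩
      p j + 2                          ≤⟨ +-monoʳ-≤ (p j) (≤-trans gap (≤-reflexive (m≤n⇒∣m-n∣≡n∸m below))) ⟩
      p j + (p (shift j h) ∸ p j)      ≡⟨ m+[n∸m]≡n below ⟩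
      p (shift j h)                    ∎)
      where open ≤-Reasoning
            gap = ≤-trans (separates j) (m⊓n≤m _ _)
    ... | inj₂ above = inj₂ (begin
      2 + p (shift j h)                      ≡⟨ +-comm 2 _ ⟩
      p (shift j h) + 2                      ≤⟨ +-monoʳ-≤ _ (≤-trans gap (≤-reflexive (m≤n⇒∣n-m∣≡n∸m above))) ⟩
      p (shift j h) + (p j ∸ p (shift j h))  ≡⟨ m+[n∸m]≡n above ⟩
      p j                                    ∎)
      where open ≤-Reasoning
            gap = ≤-trans (separates j) (m⊓n≤m _ _)

    antipode-step : ∀ j → shift (shift j h) 1 ≡ shift (shift j 1) h
    antipode-step j = shift-comm j h 1

    up-step : ∀ j → Up j → Up (shift j 1)
    up-step j up with up-or-down (shift j 1)
    ... | inj₁ up′   = up′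
    ... | inj₂ down′ = ⊥-elim (<⇒≱ (m<n+m (p j) {2} z<s) (≤-trans (s≤s j<j1h) j1h<j))
      where
      j<j1h : suc (p j) ≤ p (shift (shift j 1) h)
      j<j1h = ≤-pred (≤-trans up (subst (λ z → p (shift j h) ≤ suc (p z)) (antipode-step j) (proj₂ (moves (shift j h)))))
      j1h<j : suc (p (shift (shift j 1) h)) ≤ p j
      j1h<j = ≤-pred (≤-trans down′ (proj₁ (moves j)))

    down-step : ∀ j → Down j → Down (shift j 1)
    down-step j down with up-or-down (shift j 1)
    ... | inj₂ down′ = down′
    ... | inj₁ up′   = ⊥-elim (<⇒≱ (m<n+m (p (shift j 1)) {2} z<s) (≤-trans (s≤s j1<jh) jh<j1))
      where
      j1<jh : suc (p (shift j 1)) ≤ p (shift j h)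
      j1<jh = ≤-pred (≤-trans up′ (subst (λ z → p z ≤ suc (p (shift j h))) (antipode-step j) (proj₁ (moves (shift j h)))))
      jh<j1 : suc (p (shift j h)) ≤ p (shift j 1)
      jh<j1 = ≤-pred (≤-trans down (proj₂ (moves j)))

    up-everywhere : ∀ j → Up j → ∀ m → Up (shift j m)
    up-everywhere j up zero    = subst Up (sym (shift-zero j)) up
    up-everywhere j up (suc m) = subst Up (shift-suc j m) (up-step _ (up-everywhere j up m))

    down-everywhere : ∀ j → Down j → ∀ m → Down (shift j m)
    down-everywhere j down zero    = subst Down (sym (shift-zero j)) down
    down-everywhere j down (suc m) = subst Down (shift-suc j m) (down-step _ (down-everywhere j down m))

    once-round : Fin Q
    once-round = shift zero (h + h)

    back-home : p once-round ≤ suc (p zero) × p zero ≤ suc (p once-round)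
    back-home = by-parity halves
      where
      by-parity : Q ≡ h + h ⊎ Q ≡ suc (h + h) → p once-round ≤ suc (p zero) × p zero ≤ suc (p once-round)
      by-parity (inj₁ Q≡h+h) = subst (λ z → p z ≤ suc (p zero) × p zero ≤ suc (p z))
                                     (trans (sym (shift-Q zero)) (cong (shift zero) Q≡h+h)) (n≤1+n _ , n≤1+n _)
      by-parity (inj₂ Q≡1+h+h) = subst (λ z → p once-round ≤ suc (p z)) home (proj₂ (moves once-round)) ,
                                 subst (λ z → p z ≤ suc (p once-round)) home (proj₁ (moves once-round))
        where
        home : shift once-round 1 ≡ zero
        home = trans (shift-suc zero (h + h)) (trans (cong (shift zero) (sym Q≡1+h+h)) (shift-Q zero))

    halfway : shift (shift zero h) h ≡ once-round
    halfway = shift-shift zero h h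

    absurd : ⊥
    absurd with up-or-down zero
    ... | inj₁ up =
      <⇒≱ (m<n+m (suc (p zero)) {3} z<s) (≤-trans (≤-trans (s≤s (s≤s up)) up′) (proj₁ back-home))
      where up′ = subst (λ z → suc (suc (p (shift zero h))) ≤ p z) halfway (up-everywhere zero up h)
    ... | inj₂ down =
      <⇒≱ (m<n+m (suc (p once-round)) {3} z<s) (≤-trans (≤-trans (s≤s (s≤s down′)) down) (proj₂ back-home))
      where down′ = subst (λ z → suc (suc (p z)) ≤ p (shift zero h)) halfway (down-everywhere zero down h)

  lipschitz-separating⇒surjective : ∀ σ → 1-Lipschitz σ → SeparatesAntipodes σ → ∀ i → ∃ λ j → σ j ≡ i
  lipschitz-separating⇒surjective σ lipschitz separates i with any? (λ j → σ j ≟ᶠ i)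
  ... | yes hit = hit
  ... | no miss = ⊥-elim (AvoidingLast.absurd σ′ lipschitz′ separates′ avoids)
    where
    t = q' ∸ toℕ i
    σ′ : Fin Q → Fin Q
    σ′ j = shift (σ j) t
    lipschitz′ : 1-Lipschitz σ′
    lipschitz′ j = subst (_≤ 1) (sym (cycDist-shift (σ j) _ t)) (lipschitz j)
    separates′ : SeparatesAntipodes σ′
    separates′ j = subst (2 ≤_) (sym (cycDist-shift (σ j) _ t)) (separates j)
    i↦last : toℕ (shift i t) ≡ q'
    i↦last = trans (toℕ-shift i t (s≤s (≤-reflexive i+t≡q'))) i+t≡q'
      where i+t≡q' = m+[n∸m]≡n (≤-pred (toℕ<n i))
    avoids : ∀ j → toℕ (σ′ j) ≢ q'
    avoids j σ′j≡q' = miss (j , shift-injective t (≤-trans (m∸n≤m q' (toℕ i)) (n≤1+n q'))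
                                    (toℕ-injective (trans σ′j≡q' (sym i↦last))))

module Balls {n : ℕ} (G : Graph n) where

  Adj-sym : ∀ {u v} → Adj G u v → Adj G v u
  Adj-sym {u} {v} = subst T (Graph.sym G u v)

  Adj⇒≢ : ∀ {u v} → Adj G u v → u ≢ v
  Adj⇒≢ {u} u~u refl = subst T (Graph.irrefl G u) u~u

  _++ʷ_ : ∀ {u v w a b} → Walk G u v a → Walk G v w b → Walk G u w (a + b)
  here       ++ʷ q = q
  step u~x p ++ʷ q = step u~x (p ++ʷ q)

  snocʷ : ∀ {u v w a} → Walk G u v a → Adj G v w → Walk G u w (suc a)
  snocʷ here       v~w = step v~w here
  snocʷ (step u~x p) v~w = step u~x (snocʷ p v~w)

  reverseʷ : ∀ {u v a} → Walk G u v a → Walk G v u a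
  reverseʷ here         = here
  reverseʷ (step u~x p) = snocʷ (reverseʷ p) (Adj-sym u~x)

  InBall-refl : ∀ {u} → InBall G 0 u u
  InBall-refl = 0 , z≤n , here

  InBall-adj : ∀ {u v} → Adj G u v → InBall G 1 u v
  InBall-adj u~v = 1 , ≤-refl , step u~v here

  InBall-weaken : ∀ {i j u v} → i ≤ j → InBall G i u v → InBall G j u v
  InBall-weaken i≤j (a , a≤i , p) = a , ≤-trans a≤i i≤j , p

  InBall-sym : ∀ {i u v} → InBall G i u v → InBall G i v u
  InBall-sym (a , a≤i , p) = a , a≤i , reverseʷ p

  InBall-trans : ∀ {i j u v w} → InBall G i u v → InBall G j v w → InBall G (i + j) u w
  InBall-trans (a , a≤i , p) (b , b≤j , q) = a + b , +-mono-≤ a≤i b≤j , p ++ʷ q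

  module _ {m : ℕ} {c : Fin m → Fin n} (isometric : IsIsometricCycle G m c) where

    isometric-≤ : ∀ {i j r} → InBall G r (c i) (c j) → cycDist i j ≤ r
    isometric-≤ {i} {j} (a , a≤r , p) = ≤-trans (proj₂ (proj₂ isometric i j) a p) a≤r

    isometric-InBall : ∀ i j → InBall G (cycDist i j) (c i) (c j)
    isometric-InBall i j = cycDist i j , ≤-refl , proj₁ (proj₂ isometric i j)

module Girth {n : ℕ} (G : Graph n) (g : ℕ) (girth≤ : ∀ m (c : Fin m → Fin n) → IsCycle G m c → g ≤ m) where

  open Balls G using (Adj-sym; Adj⇒≢)

  record NBWalk : Set where
    field
      length           : ℕ
      vertex           : ℕ → Fin n
      adjacent         : ∀ i → i < length → Adj G (vertex i) (vertex (suc i))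
      non-backtracking : ∀ i → suc (suc i) ≤ length → vertex i ≢ vertex (suc (suc i))
  open NBWalk public

  module _ (W : NBWalk) where
    private
      V = vertex W

    repetition-free⇒girth≤ : ∀ a m → 1 ≤ m → a + m ≤ length W → V a ≡ V (a + m) →
                             (∀ (i j : Fin m) → toℕ i < toℕ j → V (a + toℕ i) ≢ V (a + toℕ j)) → g ≤ m
    repetition-free⇒girth≤ a 1 _ fits closed _ =
      ⊥-elim (Adj⇒≢ (adjacent W a (subst (_≤ length W) (+-comm a 1) fits)) (trans closed (cong V (+-comm a 1))))
    repetition-free⇒girth≤ a 2 _ fits closed _ =
      ⊥-elim (non-backtracking W a (subst (_≤ length W) (+-comm a 2) fits) (trans closed (cong V (+-comm a 2))))
    repetition-free⇒girth≤ a m@(suc m₁@(suc (suc _))) _ fits closed distinct =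
      girth≤ m c (s≤s (s≤s (s≤s z≤n)) , injective , cyclic)
      where
      c : Fin m → Fin n
      c i = V (a + toℕ i)
      injective : ∀ {i j} → c i ≡ c j → i ≡ j
      injective {i} {j} same with <-cmp (toℕ i) (toℕ j)
      ... | tri< i<j _ _ = ⊥-elim (distinct i j i<j same)
      ... | tri≈ _ i≡j _ = toℕ-injective i≡j
      ... | tri> _ _ j<i = ⊥-elim (distinct j i j<i (sym same))
      edge : ∀ (i : Fin m) → Adj G (V (a + toℕ i)) (V (suc (a + toℕ i)))
      edge i = adjacent W (a + toℕ i) (≤-trans (+-monoʳ-< a (toℕ<n i)) fits)
      cyclic : ∀ i → Adj G (c i) (c (shift i 1))
      cyclic i = subst (Adj G (c i)) next (edge i)
        where
        next : V (suc (a + toℕ i)) ≡ c (shift i 1)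
        next with Cyclic.shift-one m₁ i
        ... | inj₂ (_ , i+1≡) = cong V (sym (trans (cong (a +_) i+1≡) (+-suc a (toℕ i))))
        ... | inj₁ (i≡m₁ , i+1≡0) = begin
          V (suc (a + toℕ i))   ≡⟨ cong (λ k → V (suc (a + k))) i≡m₁ ⟩
          V (suc (a + m₁))      ≡⟨ cong V (+-suc a m₁) ⟨
          V (a + m)             ≡⟨ closed ⟨
          V a                   ≡⟨ cong V (trans (cong (a +_) i+1≡0) (+-identityʳ a)) ⟨
          c (shift i 1)         ∎
          where open ≡-Reasoning

    closed-segment⇒girth≤ : ∀ m → Acc _<_ m → ∀ a → 1 ≤ m → a + m ≤ length W → V a ≡ V (a + m) → g ≤ m
    closed-segment⇒girth≤ m (acc smaller) a 1≤m fits closed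
      with any? (λ (i : Fin m) → any? (λ (j : Fin m) → (toℕ i <? toℕ j) ×-dec (V (a + toℕ i) ≟ᶠ V (a + toℕ j))))
    ... | no distinct = repetition-free⇒girth≤ a m 1≤m fits closed (λ i j i<j same → distinct (i , j , i<j , same))
    ... | yes (i , j , i<j , repeat) =
      ≤-trans (closed-segment⇒girth≤ d (smaller d<m) (a + toℕ i) 1≤d fits′ closed′) (<⇒≤ d<m)
      where
      d = toℕ j ∸ toℕ i
      i+d≡j : toℕ i + d ≡ toℕ j
      i+d≡j = m+[n∸m]≡n (<⇒≤ i<j)
      d<m : d < m
      d<m = ≤-<-trans (m∸n≤m (toℕ j) (toℕ i)) (toℕ<n j)
      1≤d : 1 ≤ d
      1≤d = m<n⇒0<n∸m i<j
      a+i+d≡a+j : a + toℕ i + d ≡ a + toℕ j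
      a+i+d≡a+j = trans (+-assoc a (toℕ i) d) (cong (a +_) i+d≡j)
      fits′ : a + toℕ i + d ≤ length W
      fits′ = subst (_≤ length W) (sym a+i+d≡a+j) (≤-trans (+-monoʳ-≤ a (<⇒≤ (toℕ<n j))) fits)
      closed′ : V (a + toℕ i) ≡ V (a + toℕ i + d)
      closed′ = trans repeat (cong V (sym a+i+d≡a+j))

  trivial : Fin n → NBWalk
  trivial u = record { length = 0 ; vertex = λ _ → u ; adjacent = λ _ () ; non-backtracking = λ _ () }

  prepend : (u : Fin n) (W : NBWalk) → Adj G u (vertex W 0) → (1 ≤ length W → vertex W 1 ≢ u) → NBWalk
  prepend u W u~W₀ turns = record
    { length = suc (length W) ; vertex = vertex′ ; adjacent = adjacent′ ; non-backtracking = non-backtracking′ }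
    where
    vertex′ : ℕ → Fin n
    vertex′ zero    = u
    vertex′ (suc i) = vertex W i
    adjacent′ : ∀ i → i < suc (length W) → Adj G (vertex′ i) (vertex′ (suc i))
    adjacent′ zero    _         = u~W₀
    adjacent′ (suc i) (s≤s i<l) = adjacent W i i<l
    non-backtracking′ : ∀ i → suc (suc i) ≤ suc (length W) → vertex′ i ≢ vertex′ (suc (suc i))
    non-backtracking′ zero    (s≤s 1≤l) = turns 1≤l ∘ sym
    non-backtracking′ (suc i) (s≤s fits) = non-backtracking W i fits

  reverse : NBWalk → NBWalk
  reverse W = record
    { length = length W ; vertex = λ i → vertex W (length W ∸ i)
    ; adjacent = adjacent′ ; non-backtracking = non-backtracking′ }
    where
    ∸-suc : ∀ {i} → i < length W → length W ∸ i ≡ suc (length W ∸ suc i)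
    ∸-suc i<l = +-∸-assoc 1 i<l
    adjacent′ : ∀ i → i < length W → Adj G (vertex W (length W ∸ i)) (vertex W (length W ∸ suc i))
    adjacent′ i i<l = subst (λ k → Adj G (vertex W k) (vertex W (length W ∸ suc i))) (sym (∸-suc i<l))
                        (Adj-sym (adjacent W (length W ∸ suc i) (∸-monoʳ-< (s≤s z≤n) i<l)))
    non-backtracking′ : ∀ i → suc (suc i) ≤ length W → vertex W (length W ∸ i) ≢ vertex W (length W ∸ suc (suc i))
    non-backtracking′ i fits same =
      non-backtracking W (length W ∸ suc (suc i)) fits′ (sym (trans (cong (vertex W) (sym shifted)) same))
      where
      shifted : length W ∸ i ≡ suc (suc (length W ∸ suc (suc i)))
      shifted = trans (∸-suc (<-trans (n<1+n i) fits)) (cong suc (∸-suc fits))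
      fits′ : suc (suc (length W ∸ suc (suc i))) ≤ length W
      fits′ = subst (_≤ length W) shifted (m∸n≤m (length W) i)

  private
    splice : ℕ → (ℕ → Fin n) → (ℕ → Fin n) → ℕ → Fin n
    splice zero    f h i       = h i
    splice (suc l) f h zero    = f zero
    splice (suc l) f h (suc i) = splice l (f ∘ suc) h i

    splice-< : ∀ l f h i → i < l → splice l f h i ≡ f i
    splice-< (suc l) f h zero    _         = refl
    splice-< (suc l) f h (suc i) (s≤s i<l) = splice-< l (f ∘ suc) h i i<l

    splice-+ : ∀ l f h j → splice l f h (l + j) ≡ h j
    splice-+ zero    f h j = refl
    splice-+ (suc l) f h j = splice-+ l (f ∘ suc) h j

    splice-≤ : ∀ l f h i → f l ≡ h 0 → i ≤ l → splice l f h i ≡ f i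
    splice-≤ l f h i joins i≤l with m≤n⇒m<n∨m≡n i≤l
    ... | inj₁ i<l  = splice-< l f h i i<l
    ... | inj₂ refl = trans (cong (splice i f h) (sym (+-identityʳ i))) (trans (splice-+ i f h 0) (sym joins))

  append : (W₁ W₂ : NBWalk) → vertex W₁ (length W₁) ≡ vertex W₂ 0 →
           (1 ≤ length W₁ → 1 ≤ length W₂ → vertex W₁ (pred (length W₁)) ≢ vertex W₂ 1) → NBWalk
  append W₁ W₂ joins turns = record
    { length = l₁ + length W₂ ; vertex = S ; adjacent = adjacent′ ; non-backtracking = non-backtracking′ }
    where
    l₁ = length W₁
    S = splice l₁ (vertex W₁) (vertex W₂)
    S₁ : ∀ i → i ≤ l₁ → S i ≡ vertex W₁ i
    S₁ i = splice-≤ l₁ (vertex W₁) (vertex W₂) i joins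
    S₂ : ∀ j → S (l₁ + j) ≡ vertex W₂ j
    S₂ = splice-+ l₁ (vertex W₁) (vertex W₂)
    adjacent′ : ∀ i → i < l₁ + length W₂ → Adj G (S i) (S (suc i))
    adjacent′ i i<l with l₁ ≤? i
    ... | no l₁≰i = subst₂ (Adj G) (sym (S₁ i (<⇒≤ (≰⇒> l₁≰i)))) (sym (S₁ (suc i) (≰⇒> l₁≰i)))
                           (adjacent W₁ i (≰⇒> l₁≰i))
    ... | yes l₁≤i with m≤n⇒∃[o]m+o≡n l₁≤i
    ...   | j , refl = subst₂ (Adj G) (sym (S₂ j)) (trans (sym (S₂ (suc j))) (cong S (+-suc l₁ j)))
                         (adjacent W₂ j (+-cancelˡ-< l₁ j _ i<l))
    non-backtracking′ : ∀ i → suc (suc i) ≤ l₁ + length W₂ → S i ≢ S (suc (suc i))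
    non-backtracking′ i fits with suc (suc i) ≤? l₁ | l₁ ≤? i
    ... | yes inside₁ | _ = subst₂ _≢_ (sym (S₁ i (≤-trans (n≤1+n i) (≤-trans (n≤1+n (suc i)) inside₁))))
                                      (sym (S₁ (suc (suc i)) inside₁)) (non-backtracking W₁ i inside₁)
    ... | no _ | yes l₁≤i with m≤n⇒∃[o]m+o≡n l₁≤i
    ...   | j , refl = subst₂ _≢_ (sym (S₂ j)) (trans (sym (S₂ (suc (suc j)))) (cong S l₁+2+j))
                         (non-backtracking W₂ j (+-cancelˡ-≤ l₁ _ _ (subst (_≤ l₁ + length W₂) (sym l₁+2+j) fits)))
      where l₁+2+j = trans (+-suc l₁ (suc j)) (cong suc (+-suc l₁ j))
    non-backtracking′ i fits | no outside₁ | no l₁≰i =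
      subst₂ _≢_ (sym (trans (S₁ i (<⇒≤ (≰⇒> l₁≰i))) (cong (vertex W₁) (sym pred-l₁))))
                 (sym (trans (cong S (sym l₁+1)) (S₂ 1)))
                 (turns (≤-trans (s≤s z≤n) (≰⇒> l₁≰i)) 1≤l₂)
      where
      l₁≡ : l₁ ≡ suc i
      l₁≡ = ≤-antisym (≤-pred (≰⇒> outside₁)) (≰⇒> l₁≰i)
      pred-l₁ : pred l₁ ≡ i
      pred-l₁ = cong pred l₁≡
      l₁+1 : l₁ + 1 ≡ suc (suc i)
      l₁+1 = trans (+-comm l₁ 1) (cong suc l₁≡)
      1≤l₂ : 1 ≤ length W₂
      1≤l₂ = +-cancelˡ-≤ l₁ 1 _ (subst (_≤ l₁ + length W₂) (sym l₁+1) fits)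

  two-walks⇒girth≤ : (W₁ W₂ : NBWalk) →
                     vertex W₁ 0 ≡ vertex W₂ 0 → vertex W₁ (length W₁) ≡ vertex W₂ (length W₂) →
                     1 ≤ length W₁ + length W₂ →
                     (1 ≤ length W₁ → 1 ≤ length W₂ → vertex W₁ 1 ≢ vertex W₂ 1) →
                     g ≤ length W₁ + length W₂
  two-walks⇒girth≤ W₁ W₂ starts ends nonempty diverge =
    closed-segment⇒girth≤ W (length W₁ + length W₂) (<-wellFounded _) 0 nonempty ≤-refl closed
    where
    turns : 1 ≤ length W₁ → 1 ≤ length W₂ → vertex W₁ (length W₁ ∸ pred (length W₁)) ≢ vertex W₂ 1
    turns 1≤l₁ 1≤l₂ = subst (λ k → vertex W₁ k ≢ vertex W₂ 1) (sym (m∸pred[m]≡1 1≤l₁)) (diverge 1≤l₁ 1≤l₂)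
      where m∸pred[m]≡1 : ∀ {m} → 1 ≤ m → m ∸ pred m ≡ 1
            m∸pred[m]≡1 {suc m} _ = trans (+-∸-assoc 1 (≤-refl {m})) (cong suc (n∸n≡0 m))
    joins : vertex (reverse W₁) (length W₁) ≡ vertex W₂ 0
    joins = trans (cong (vertex W₁) (n∸n≡0 (length W₁))) starts
    W = append (reverse W₁) W₂ joins turns
    closed : vertex W 0 ≡ vertex W (0 + (length W₁ + length W₂))
    closed = trans (splice-≤ (length W₁) (vertex (reverse W₁)) (vertex W₂) 0 joins z≤n)
                   (trans ends (sym (splice-+ (length W₁) (vertex (reverse W₁)) (vertex W₂) (length W₂))))

module TreeCount {n : ℕ} (G : Graph n) (g : ℕ) (girth≤ : ∀ m (c : Fin m → Fin n) → IsCycle G m c → g ≤ m)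
                 (δ : ℕ) (min-degree : ∀ u → δ ≤ degree G u) where

  open Balls G using (Adj⇒≢)
  open Girth G g girth≤
  open Graph G using (adj)
  open Equivalence using (to; from)

  _≟ᵇ_ : Fin n → Fin n → Bool
  u ≟ᵇ v = isYes (u ≟ᶠ v)

  children : Fin n → Fin n → Fin n → Bool
  children r p x = adj r x ∧ not (x ≟ᵇ p)

  -- v ends a non-backtracking walk of length ≤ t from r whose first step does not go to p.
  nbBall : ℕ → Fin n → Fin n → Fin n → Bool
  nbBall zero    r p v = r ≟ᵇ v
  nbBall (suc t) r p v = (r ≟ᵇ v) ∨ anyᵇ (λ x → children r p x ∧ nbBall t x r v)

  Via : ℕ → Fin n → Fin n → Fin n → Fin n → Bool
  Via t r p x v = children r p x ∧ nbBall t x r v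

  ≟ᵇ-refl : ∀ u → T (u ≟ᵇ u)
  ≟ᵇ-refl u = fromWitness {a? = u ≟ᶠ u} refl

  children-intro : ∀ {r p x} → Adj G r x → x ≢ p → T (children r p x)
  children-intro {p = p} {x} r~x x≢p = from T-∧ (r~x , fromWitnessFalse {a? = x ≟ᶠ p} x≢p)

  children-elim : ∀ {r p x} → T (children r p x) → Adj G r x × x ≢ p
  children-elim {r} {p} {x} ok with to (T-∧ {adj r x}) ok
  ... | r~x , x≢p = r~x , toWitnessFalse {a? = x ≟ᶠ p} x≢p

  nbBall-intro : ∀ t {r p x v} → T (children r p x) → T (nbBall t x r v) → T (nbBall (suc t) r p v)
  nbBall-intro t {r} {p} {x} {v} ok reach =
    from (T-∨ {r ≟ᵇ v}) (inj₂ (anyᵇ-intro (λ y → Via t r p y v) x (from T-∧ (ok , reach))))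

  nbBall-elim : ∀ t {r p v} → T (nbBall (suc t) r p v) → r ≡ v ⊎ ∃ λ x → T (children r p x) × T (nbBall t x r v)
  nbBall-elim t {r} {p} {v} reach with to (T-∨ {r ≟ᵇ v}) reach
  ... | inj₁ r≡v  = inj₁ (toWitness {a? = r ≟ᶠ v} r≡v)
  ... | inj₂ some with anyᵇ-elim (λ x → Via t r p x v) some
  ...   | x , via = inj₂ (x , to (T-∧ {children r p x}) via)

  nbBall⇒InBall : ∀ t {r p v} → T (nbBall t r p v) → InBall G t r v
  nbBall⇒InBall zero {r} {v = v} r≡v = 0 , z≤n , subst (λ v → Walk G r v 0) (toWitness {a? = r ≟ᶠ v} r≡v) here
  nbBall⇒InBall (suc t) reach with nbBall-elim t reach
  ... | inj₁ refl = 0 , z≤n , here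
  ... | inj₂ (x , ok , x-reach) with nbBall⇒InBall t x-reach
  ...   | m , m≤t , walk = suc m , s≤s m≤t , step (proj₁ (children-elim ok)) walk

  record NBReach (t : ℕ) (r p v : Fin n) : Set where
    field
      walk   : NBWalk
      short  : length walk ≤ t
      starts : vertex walk 0 ≡ r
      ends   : vertex walk (length walk) ≡ v
      avoids : 1 ≤ length walk → vertex walk 1 ≢ p

    behind : Adj G p r → NBWalk
    behind p~r = prepend p walk (subst (Adj G p) (sym starts) p~r) avoids
  open NBReach

  nbBall⇒NBReach : ∀ t {r p v} → T (nbBall t r p v) → NBReach t r p v
  nbBall⇒NBReach zero {r} {v = v} r≡v = record
    { walk = trivial r ; short = z≤n ; starts = refl ; ends = toWitness {a? = r ≟ᶠ v} r≡v ; avoids = λ () }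
  nbBall⇒NBReach (suc t) {r} reach with nbBall-elim t reach
  ... | inj₁ refl = record { walk = trivial r ; short = z≤n ; starts = refl ; ends = refl ; avoids = λ () }
  ... | inj₂ (x , ok , x-reach) with children-elim ok | nbBall⇒NBReach t x-reach
  ...   | r~x , x≢p | R = record
    { walk = behind R r~x ; short = s≤s (short R) ; starts = refl ; ends = ends R
    ; avoids = λ _ → x≢p ∘ trans (sym (starts R)) }

  root-not-revisited : ∀ t {r x} → suc t < g → Adj G r x → ¬ T (nbBall t x r r)
  root-not-revisited t {r} {x} lt r~x back =
    <⇒≱ lt (≤-trans (two-walks⇒girth≤ (trivial r) (behind R r~x) refl (sym (ends R)) (s≤s z≤n) (λ ())) (s≤s (short R)))
    where R : NBReach t x r r
          R = nbBall⇒NBReach t back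

  branches-disjoint : ∀ t {r x x′ v} → suc t + suc t < g → Adj G r x → Adj G r x′ → x ≢ x′ →
                      T (nbBall t x r v) → ¬ T (nbBall t x′ r v)
  branches-disjoint t {r} {x} {x′} {v} lt r~x r~x′ x≢x′ reach reach′ =
    <⇒≱ lt (≤-trans cycle (+-mono-≤ (s≤s (short R)) (s≤s (short R′))))
    where
    R : NBReach t x r v
    R = nbBall⇒NBReach t reach
    R′ : NBReach t x′ r v
    R′ = nbBall⇒NBReach t reach′
    cycle : g ≤ suc (length (walk R)) + suc (length (walk R′))
    cycle = two-walks⇒girth≤ (behind R r~x) (behind R′ r~x′) refl (trans (ends R) (sym (ends R′))) (s≤s z≤n)
                              (λ _ _ same → x≢x′ (trans (sym (starts R)) (trans same (starts R′))))

  halves-disjoint : ∀ t {u u′ v} → suc (t + t) < g → Adj G u u′ → T (nbBall t u u′ v) → ¬ T (nbBall t u′ u v)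
  halves-disjoint t {u} {u′} {v} lt u~u′ reach reach′ =
    <⇒≱ lt (≤-trans cycle (≤-trans (+-mono-≤ (short R) (s≤s (short R′))) (≤-reflexive (+-suc t t))))
    where
    R : NBReach t u u′ v
    R = nbBall⇒NBReach t reach
    R′ : NBReach t u′ u v
    R′ = nbBall⇒NBReach t reach′
    cycle : g ≤ length (walk R) + suc (length (walk R′))
    cycle = two-walks⇒girth≤ (walk R) (behind R′ u~u′) (starts R) (trans (ends R) (sym (ends R′)))
                              (≤-trans (s≤s z≤n) (m≤n+m _ (length (walk R))))
                              (λ 1≤l _ same → avoids R 1≤l (trans same (starts R′)))

  private
    via-adj : ∀ t {r p x} v → T (Via t r p x v) → Adj G r x
    via-adj t {r} {p} {x} v via = proj₁ (children-elim (proj₁ (to (T-∧ {children r p x}) via)))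

    via-reach : ∀ t {r p x} v → T (Via t r p x v) → T (nbBall t x r v)
    via-reach t {r} {p} {x} v via = proj₂ (to (T-∧ {children r p x}) via)

  -- Girth > 2t + 2 makes the branches below r disjoint and keeps them away from r.
  per-vertex : ∀ t r p v → suc t + suc t < g →
               bit (r ≟ᵇ v) + count (λ x → Via t r p x v) ≤ bit (nbBall (suc t) r p v)
  per-vertex t r p v lt with r ≟ᶠ v
  ... | yes refl = ≤-reflexive (cong suc (count≡0 (λ x → Via t r p x r)
                     λ x via → root-not-revisited t (≤-<-trans (m≤m+n (suc t) (suc t)) lt) (via-adj t r via) (via-reach t r via)))
  ... | no _ = count-≤-anyᵇ (λ x → Via t r p x v) unique
    where
    unique : ∀ x y → T (Via t r p x v) → T (Via t r p y v) → x ≡ y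
    unique x y via-x via-y with x ≟ᶠ y
    ... | yes x≡y = x≡y
    ... | no x≢y = ⊥-elim (branches-disjoint t lt (via-adj t v via-x) (via-adj t v via-y) x≢y
                                              (via-reach t v via-x) (via-reach t v via-y))

  nbBall-suc-count : ∀ t r p → suc t + suc t < g → ∀ B → (∀ x → B ≤ count (nbBall t x r)) →
                     1 + count (children r p) * B ≤ count (nbBall (suc t) r p)
  nbBall-suc-count t r p lt B B≤ = begin
    1 + count (children r p) * B                                      ≡⟨ cong (1 +_) (*-distribʳ-sum B (bit ∘ children r p)) ⟩
    1 + ∑[ x < n ] (bit (children r p x) * B)                         ≤⟨ +-mono-≤ (count-≥-1 (r ≟ᵇ_) r (≟ᵇ-refl r))
                                                                           (sum-mono-≤ λ x → *-monoʳ-≤ (bit (children r p x)) (B≤ x)) ⟩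
    count (r ≟ᵇ_) + ∑[ x < n ] (bit (children r p x) * count (nbBall t x r))
                                                                      ≡⟨ cong (count (r ≟ᵇ_) +_) (sum-cong-≗ λ x → trans
                                                                           (*-distribˡ-sum (bit (children r p x)) (bit ∘ nbBall t x r))
                                                                           (sum-cong-≗ λ v → sym (bit-∧ (children r p x) (nbBall t x r v)))) ⟩
    count (r ≟ᵇ_) + ∑[ x < n ] count (λ v → Via t r p x v)            ≡⟨ cong (count (r ≟ᵇ_) +_) (∑-comm (λ x v → bit (Via t r p x v))) ⟩
    count (r ≟ᵇ_) + ∑[ v < n ] count (λ x → Via t r p x v)            ≡⟨ ∑-distrib-+ (bit ∘ (r ≟ᵇ_)) (λ v → count (λ x → Via t r p x v)) ⟨
    ∑[ v < n ] (bit (r ≟ᵇ v) + count (λ x → Via t r p x v))          ≤⟨ sum-mono-≤ (λ v → per-vertex t r p v lt) ⟩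
    count (nbBall (suc t) r p)                                        ∎
    where open ≤-Reasoning

  degree≡count : ∀ u → degree G u ≡ count (adj u)
  degree≡count u = listSum-map-tabulate (bit ∘ adj u) id

  children-count : ∀ r p → δ ∸ 1 ≤ count (children r p)
  children-count r p = m≤n+o⇒m∸n≤o δ 1 (begin
    δ                                            ≤⟨ min-degree r ⟩
    degree G r                                   ≡⟨ degree≡count r ⟩
    count (adj r)                                ≤⟨ sum-mono-≤ split ⟩
    ∑[ x < n ] (bit (x ≟ᵇ p) + bit (children r p x)) ≡⟨ ∑-distrib-+ (bit ∘ (_≟ᵇ p)) (bit ∘ children r p) ⟩
    count (_≟ᵇ p) + count (children r p)         ≤⟨ +-monoˡ-≤ _ (≤-trans (count-≤-anyᵇ (_≟ᵇ p) unique) (bit≤1 _)) ⟩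
    1 + count (children r p)                     ∎)
    where
    open ≤-Reasoning
    split : ∀ x → bit (adj r x) ≤ bit (x ≟ᵇ p) + bit (children r p x)
    split x with adj r x | x ≟ᵇ p
    ... | false | _     = z≤n
    ... | true  | true  = s≤s z≤n
    ... | true  | false = ≤-refl
    unique : ∀ x y → T (x ≟ᵇ p) → T (y ≟ᵇ p) → x ≡ y
    unique x y x≡p y≡p = trans (toWitness {a? = x ≟ᶠ p} x≡p) (sym (toWitness {a? = y ≟ᶠ p} y≡p))

  root-children-count : ∀ r → δ ≤ count (children r r)
  root-children-count r = begin
    δ               ≤⟨ min-degree r ⟩
    degree G r      ≡⟨ degree≡count r ⟩
    count (adj r)   ≤⟨ count-mono (λ x r~x → children-intro {r} {r} {x} r~x (Adj⇒≢ r~x ∘ sym)) ⟩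
    count (children r r) ∎
    where open ≤-Reasoning

  nbBall-count : ∀ t → t + t < g → ∀ r p → branchSize δ t ≤ count (nbBall t r p)
  nbBall-count zero    _  r p = count-≥-1 (r ≟ᵇ_) r (≟ᵇ-refl r)
  nbBall-count (suc t) lt r p =
    ≤-trans (+-monoʳ-≤ 1 (*-monoˡ-≤ (branchSize δ t) (children-count r p)))
            (nbBall-suc-count t r p lt (branchSize δ t) (λ x → nbBall-count t lt′ x r))
    where lt′ = ≤-<-trans (+-mono-≤ (n≤1+n t) (n≤1+n t)) lt

  -- nbBall t u u excludes no first step, u not being its own neighbour.
  ball-count : ∀ t u → suc t + suc t < g → 1 + δ * branchSize δ t ≤ count (nbBall (suc t) u u)
  ball-count t u lt =
    ≤-trans (+-monoʳ-≤ 1 (*-monoˡ-≤ (branchSize δ t) (root-children-count u)))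
            (nbBall-suc-count t u u lt (branchSize δ t) (λ x → nbBall-count t lt′ x u))
    where lt′ = ≤-<-trans (+-mono-≤ (n≤1+n t) (n≤1+n t)) lt

  nbBall-unrestricted : ∀ t {r p v} → T (nbBall t r p v) → T (nbBall t r r v)
  nbBall-unrestricted zero    reach = reach
  nbBall-unrestricted (suc t) {r} reach with nbBall-elim t reach
  ... | inj₁ refl = from (T-∨ {r ≟ᵇ r}) (inj₁ (≟ᵇ-refl r))
  ... | inj₂ (x , ok , x-reach) =
    let r~x , _ = children-elim ok in nbBall-intro t (children-intro {r} {r} {x} r~x (Adj⇒≢ r~x ∘ sym)) x-reach

  edge-ball-count : ∀ t {u u′} → suc (t + t) < g → Adj G u u′ →
                    2 * branchSize δ t ≤ count (λ v → nbBall t u u v ∨ nbBall t u′ u′ v)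
  edge-ball-count t {u} {u′} lt u~u′ = begin
    2 * branchSize δ t                                          ≡⟨ cong (branchSize δ t +_) (+-identityʳ _) ⟩
    branchSize δ t + branchSize δ t                             ≤⟨ +-mono-≤ (nbBall-count t lt′ u u′) (nbBall-count t lt′ u′ u) ⟩
    count (nbBall t u u′) + count (nbBall t u′ u)               ≡⟨ ∑-distrib-+ (bit ∘ nbBall t u u′) (bit ∘ nbBall t u′ u) ⟨
    ∑[ v < n ] (bit (nbBall t u u′ v) + bit (nbBall t u′ u v))  ≤⟨ sum-mono-≤ merge ⟩
    count (λ v → nbBall t u u v ∨ nbBall t u′ u′ v)             ∎
    where
    open ≤-Reasoning
    lt′ = ≤-<-trans (n≤1+n _) lt
    merge : ∀ v → bit (nbBall t u u′ v) + bit (nbBall t u′ u v) ≤ bit (nbBall t u u v ∨ nbBall t u′ u′ v)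
    merge v with nbBall t u u′ v in e | nbBall t u′ u v in e′
    ... | false | false = z≤n
    ... | true  | true  = ⊥-elim (halves-disjoint t lt u~u′ (subst T (sym e) tt) (subst T (sym e′) tt))
    ... | true  | false = T⇒1≤bit (from T-∨ (inj₁ (nbBall-unrestricted t (subst T (sym e) tt))))
    ... | false | true  = T⇒1≤bit (from (T-∨ {nbBall t u u v}) (inj₂ (nbBall-unrestricted t (subst T (sym e′) tt))))

module Centre (q' k : ℕ) (room : 3 * (k + k) + 3 ≤ suc q') {n : ℕ} (G : Graph n)
              (c : Fin (suc q') → Fin n) (isometric : IsIsometricCycle G (suc q') c) where

  open Cyclic q'
  open Balls G

  K : ℕ
  K = k + k

  private
    3K+2<Q : K + K + K + 2 < Q
    3K+2<Q = ≤-trans (≤-reflexive (eq K)) room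
      where eq : ∀ K → suc (K + K + K + 2) ≡ 3 * K + 3
            eq = solve-∀

    spread<Q : ∀ {a b} → a ≤ K + 1 → b ≤ K + 1 → a + K + b < Q
    spread<Q a≤ b≤ = ≤-<-trans (≤-trans (+-mono-≤ (+-monoˡ-≤ K a≤) b≤) (≤-reflexive (eq K))) 3K+2<Q
      where eq : ∀ K → K + 1 + K + (K + 1) ≡ K + K + K + 2
            eq = solve-∀

    one-sided : ∀ (s t : Fin Q) {ρ e} → e ≤ 1 → t ≡ shift s ρ → ρ ≤ K + e → cycDist s (shift t K) ≤ K + e → ρ ≤ e
    one-sided s t {ρ} {e} e≤1 t≡ ρ≤ far = conclude (∥d∥≤m⇒ (subst (_≤ K + e) gap far))
      where
      ρ≤K+1 : ρ ≤ K + 1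
      ρ≤K+1 = ≤-trans ρ≤ (+-monoʳ-≤ K e≤1)
      ρ+K<Q : ρ + K < Q
      ρ+K<Q = ≤-<-trans (m≤m+n (ρ + K) 0) (spread<Q ρ≤K+1 z≤n)
      gap : cycDist s (shift t K) ≡ ∥ ρ + K ∥
      gap = trans (cong (λ z → cycDist s (shift z K)) t≡)
                  (trans (cong (cycDist s) (shift-shift s ρ K)) (cycDist-shiftʳ s (ρ + K) ρ+K<Q))
      conclude : ρ + K ≤ K + e ⊎ Q ≤ ρ + K + (K + e) → ρ ≤ e
      conclude (inj₁ ρ+K≤K+e) = +-cancelʳ-≤ K ρ e (subst (ρ + K ≤_) (+-comm K e) ρ+K≤K+e)
      conclude (inj₂ Q≤ρ+K+K+e) = ⊥-elim (<⇒≱ (spread<Q ρ≤K+1 (+-monoʳ-≤ K e≤1)) Q≤ρ+K+K+e)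

  centre-arith : ∀ (s t : Fin Q) {e} → e ≤ 1 → cycDist s t ≤ K + e →
                 cycDist s (shift t K) ≤ K + e → cycDist t (shift s K) ≤ K + e → cycDist s t ≤ e
  centre-arith s t e≤1 near st-far ts-far with cycDist-witness s t
  ... | inj₁ t≡ = one-sided s t e≤1 t≡ near st-far
  ... | inj₂ s≡ = subst (_≤ _) (cycDist-sym t s) (one-sided t s e≤1 (trans s≡ (cong (shift t) (cycDist-sym s t)))
                                                     (subst (_≤ _) (cycDist-sym s t) near) ts-far)

  k≤Q : k ≤ Q
  k≤Q = ≤-trans (m≤m+n k _) (≤-trans (≤-reflexive (eq k)) (<⇒≤ 3K+2<Q))
    where eq : ∀ k → k + (k + (k + k) + (k + k) + 2) ≡ (k + k) + (k + k) + (k + k) + 2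
          eq = solve-∀

  centres-close : ∀ {s t v w e} → e ≤ 1 → InL G k Q c s v → InL G k Q c t w → InBall G e v w → cycDist s t ≤ e
  centres-close {s} {t} {v} {w} {e} e≤1 (s⁻ , s⁺) (t⁻ , t⁺) v~w = centre-arith s t e≤1 near st-far ts-far
    where
    via : ∀ {x y} → InBall G k (c x) v → InBall G k (c y) w → cycDist x y ≤ K + e
    via {x} {y} X Y = subst (cycDist x y ≤_) (length k e)
                        (isometric-≤ isometric (InBall-trans X (InBall-trans v~w (InBall-sym Y))))
      where length : ∀ k e → k + (e + k) ≡ k + k + e
            length = solve-∀
    near : cycDist s t ≤ K + e
    near = subst (_≤ K + e) (cycDist-shift s t (Q ∸ k)) (via s⁻ t⁻)
    st-far : cycDist s (shift t K) ≤ K + e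
    st-far = subst (_≤ K + e) (trans (sym (cycDist-shift (shift s (Q ∸ k)) (shift t k) k))
                                     (cong₂ cycDist (shift-inverseˡ s k≤Q) (shift-shift t k k)))
                   (via s⁻ t⁺)
    ts-far : cycDist t (shift s K) ≤ K + e
    ts-far = subst (_≤ K + e) (trans (sym (cycDist-shift (shift s k) (shift t (Q ∸ k)) k))
                                     (trans (cong₂ cycDist (shift-shift s k k) (shift-inverseˡ t k≤Q)) (cycDist-sym (shift s K) t)))
                   (via s⁺ t⁻)

  centre-unique : ∀ {s t v} → InL G k Q c s v → InL G k Q c t v → s ≡ t
  centre-unique {s} {t} Ls Lt = cycDist≤0⇒≡ (centres-close {s} {t} z≤n Ls Lt InBall-refl)

module Proof {n : ℕ} (G : Graph n) (g δ q' : ℕ)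
             (3≤g : 3 ≤ g) (girth≤ : ∀ m (c : Fin m → Fin n) → IsCycle G m c → g ≤ m)
             (min-degree : ∀ u → δ ≤ degree G u) (long : 6 * kOf g + 3 < suc q')
             (order : n * g ≡ suc q' * moore δ g)
             (c : Fin (suc q') → Fin n) (c-isometric : IsIsometricCycle G (suc q') c)
             (d : Fin (suc q') → Fin n) (d-isometric : IsIsometricCycle G (suc q') d) where

  open Cyclic q'
  open Balls G
  open TreeCount G g girth≤ δ min-degree

  k : ℕ
  k = kOf g

  3K+4≤Q : 3 * (k + k) + 4 ≤ Q
  3K+4≤Q = subst (_≤ Q) (six k) long
    where six : ∀ k → suc (6 * k + 3) ≡ 3 * (k + k) + 4
          six = solve-∀

  open Arc q' (k + k) (≤-trans (n≤1+n _) (≤-trans (≤-reflexive (sym (+-suc _ 3))) 3K+4≤Q))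
  open Centre q' k (≤-trans (n≤1+n _) (≤-trans (≤-reflexive (sym (+-suc _ 3))) 3K+4≤Q)) G c c-isometric

  ballAt : Fin n → Fin Q → Bool
  ballAt v j = nbBall k (c j) (c j) v

  clustered : ∀ v → Clustered (ballAt v)
  clustered v i j near-i near-j =
    isometric-≤ c-isometric (InBall-trans (nbBall⇒InBall k near-i) (InBall-sym (nbBall⇒InBall k near-j)))

  arc⇒centre : ∀ {v} → HasArc (ballAt v) → ∃ λ s → InL G k Q c s v
  arc⇒centre {v} (a , near-a , near-a+K) =
    shift a k ,
    subst (λ x → InBall G k (c x) v) (sym (shift-inverseʳ a k≤Q)) (nbBall⇒InBall k near-a) ,
    subst (λ x → InBall G k (c x) v) (sym (shift-shift a k k)) (nbBall⇒InBall k near-a+K)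

  c-adjacent : ∀ j → Adj G (c j) (c (shift j 1))
  c-adjacent = proj₂ (proj₂ (proj₁ c-isometric))

  arc : ∀ v → GirthShape δ g → HasArc (ballAt v)
  arc v (odd k′ k≡1+k′ g≡1+K moore≡) =
    proj₂ (clustered-count (clustered v)) (subst (_≤ count (ballAt v)) g≡1+K (tight v))
    where
    rows : ∀ j → moore δ g ≤ count (λ v → ballAt v j)
    rows j = subst₂ _≤_ (sym moore≡) (cong (λ t → count (nbBall t (c j) (c j))) (sym k≡1+k′))
               (ball-count k′ (c j) (subst (_< g) (cong (λ t → t + t) k≡1+k′) (subst (K <_) (sym g≡1+K) ≤-refl)))
    columns : ∀ v → count (ballAt v) ≤ g
    columns v = subst (count (ballAt v) ≤_) (sym g≡1+K) (proj₁ (clustered-count (clustered v)))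
    tight : ∀ v → g ≤ count (ballAt v)
    tight = columns-full (λ j v → ballAt v j) (moore δ g) g rows columns (≤-reflexive order)
  arc v (even g≡2+K moore≡) =
    proj₂ (clustered-thick-count (clustered v)) (subst (_≤ count (thicken (ballAt v))) g≡2+K (tight v))
    where
    rows : ∀ j → moore δ g ≤ count (λ v → thicken (ballAt v) j)
    rows j = subst (_≤ count (λ v → thicken (ballAt v) j)) (sym moore≡)
               (edge-ball-count k (subst (suc K <_) (sym g≡2+K) ≤-refl) (c-adjacent j))
    columns : ∀ v → count (thicken (ballAt v)) ≤ g
    columns v = subst (count (thicken (ballAt v)) ≤_) (sym g≡2+K) (proj₁ (clustered-thick-count (clustered v)))
    tight : ∀ v → g ≤ count (thicken (ballAt v))
    tight = columns-full (λ j v → thicken (ballAt v) j) (moore δ g) g rows columns (≤-reflexive order)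

  every-vertex-has-centre : ∀ v → ∃ λ s → InL G k Q c s v
  every-vertex-has-centre v = arc⇒centre (arc v (girth-shape δ g 3≤g))

  σ : Fin Q → Fin Q
  σ j = proj₁ (every-vertex-has-centre (d j))

  σ-centre : ∀ j → InL G k Q c (σ j) (d j)
  σ-centre j = proj₂ (every-vertex-has-centre (d j))

  h : ℕ
  h = proj₁ (even-or-odd Q)

  halves : Q ≡ h + h ⊎ Q ≡ suc (h + h)
  halves = proj₂ (even-or-odd Q)

  open Winding q' h halves

  σ-lipschitz : 1-Lipschitz σ
  σ-lipschitz j = centres-close {σ j} {σ (shift j 1)} ≤-refl (σ-centre j) (σ-centre (shift j 1))
                    (InBall-adj (proj₂ (proj₂ (proj₁ d-isometric)) j))

  σ-separates : SeparatesAntipodes σ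
  σ-separates j = ≰⇒> λ close → <⇒≱ 2K+3<Q (≤-trans Q≤1+h+h (s≤s (+-mono-≤ (h≤ close) (h≤ close))))
    where
    2K+3<Q : suc (K + 1 + (K + 1)) < Q
    2K+3<Q = ≤-trans (m≤m+n _ K) (subst (_≤ Q) (sym (eq K)) 3K+4≤Q)
      where eq : ∀ K → suc (suc (K + 1 + (K + 1))) + K ≡ 3 * K + 4
            eq = solve-∀
    h≤ : cycDist (σ j) (σ (shift j h)) ≤ 1 → h ≤ K + 1
    h≤ close = [ (λ h≤ → subst (h ≤_) (len k) h≤) ,
                 (λ Q≤ → +-cancelˡ-≤ h h (K + 1) (≤-trans h+h≤Q (subst (λ r → Q ≤ h + r) (len k) Q≤))) ]′
                 (∥d∥≤m⇒ (subst (_≤ k + (1 + k)) (cycDist-shiftʳ j h h<Q) apart))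
      where
      len : ∀ k → k + (1 + k) ≡ k + k + 1
      len = solve-∀
      s⁻ t⁻ : Fin Q
      s⁻ = shift (σ j) (Q ∸ k)
      t⁻ = shift (σ (shift j h)) (Q ∸ k)
      centres-adjacent : InBall G 1 (c s⁻) (c t⁻)
      centres-adjacent = InBall-weaken (subst (_≤ 1) (sym (cycDist-shift (σ j) (σ (shift j h)) (Q ∸ k))) close)
                                       (isometric-InBall c-isometric s⁻ t⁻)
      apart : cycDist j (shift j h) ≤ k + (1 + k)
      apart = isometric-≤ d-isometric
                (InBall-trans (InBall-sym (proj₁ (σ-centre j))) (InBall-trans centres-adjacent (proj₁ (σ-centre (shift j h)))))

  σ-surjective : ∀ i → ∃ λ j → σ j ≡ i
  σ-surjective = lipschitz-separating⇒surjective σ σ-lipschitz σ-separates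

  σ-injective : ∀ {j j′} → σ j ≡ σ j′ → j ≡ j′
  σ-injective = surjective⇒injective σ σ-surjective

  ExactlyOneOnD : Fin Q → Set
  ExactlyOneOnD i = Σ (Fin n) λ v → (OnCycle d v × InL G k Q c i v)
                                   × (∀ w → OnCycle d w → InL G k Q c i w → w ≡ v)

  preimage⇒unique : ∀ {i} → (∃ λ j → σ j ≡ i) → ExactlyOneOnD i
  preimage⇒unique {i} (j , σj≡i) = d j , ((j , refl) , subst (λ s → InL G k Q c s (d j)) σj≡i (σ-centre j)) , unique
    where
    unique : ∀ w → OnCycle d w → InL G k Q c i w → w ≡ d j
    unique w (j′ , refl) L-w = cong d (σ-injective (trans (centre-unique {σ j′} (σ-centre j′) L-w) (sym σj≡i)))

  exactly-one-on-D : ∀ i → ExactlyOneOnD i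
  exactly-one-on-D i = preimage⇒unique (σ-surjective i)

lemma21 : ∀ {n} (G : Graph n) (g δ q : ℕ) → Equatorial G g δ q
          → (c : Fin q → Fin n) → IsIsometricCycle G q c
          → (d : Fin q → Fin n) → IsIsometricCycle G q d
          → ∀ (i : Fin q) →
            -- |V(D) ∩ L_i| = 1 : exactly one vertex lies in V(D) ∩ L_i
            Σ (Fin n) λ v → (OnCycle d v × InL G (kOf g) q c i v)
              × (∀ w → OnCycle d w → InL G (kOf g) q c i w → w ≡ v)
lemma21 G g δ (suc q') (_ , 3≤g , (_ , girth≤) , (min-degree , _) , _ , long , order) c c-isometric d d-isometric =
  Proof.exactly-one-on-D G g δ q' 3≤g girth≤ min-degree long order c c-isometric d d-isometric
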